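{- Fix $m\ge4$, a rearrangement $p_1,\ldots,p_{m-2}$ of $3,\ldots,m$, and let $\tau=red(p_1\cdots p_{m-2})\in S_{m-2}$, $P_1=1\underline{2}p_1\cdots p_{m-2}$, $P_2=\underline{2}1p_1\cdots p_{m-2}$. Let $n\ge1$ and $Q\subseteq[n]\times[n]$ with $S_n^Q\neq\emptyset$. Then $$\sum_{\pi\in S_n^Q}x^{pmp_{P_1}(\pi)}=\sum_{\pi\in S_{\lambda(Q)}}x^{pmp_{1\underline{2}}(\pi)}\quad\text{and}\quad\sum_{\pi\in S_n^Q}x^{pmp_{P_2}(\pi)}=\sum_{\pi\in S_{\lambda(Q)}}x^{pmp_{\underline{2}1}(\pi)}.$$
   Context: Positional marked patterns: a permutation of $[k]$ with one entry underlined; for $\sigma\in S_n$, a $\rho$-match at position $\ell$ means an occurrence $\sigma_{i_1}\cdots\sigma_{i_k}$ of the underlying permutation of $\rho$ (same relative order) with $i_{u}=\ell$, $u$ the underlined position; $pmp_\rho(\sigma)$ counts such positions. Here $P_1$ has underlined $2$ in position 2 and $P_2$ has underlined $2$ in position 1. The diagram of $\pi\in S_n$ is the $n\times n$ grid of cells $(a,b)$ (column $a$, row $b$, counted from left and from bottom) with a cross in cell $(a,\pi_a)$ for each $a$. A cell $(a,b)$ is dominant for $\pi$ if there are columns $a<c_1<\cdots<c_{m-2}$ with $\pi_{c_j}>b$ for all $j$ and $red(\pi_{c_1}\cdots\pi_{c_{m-2}})=\tau$; otherwise non-dominant. $ND(\pi)$ is the set of cells containing a cross that are non-dominant, and $S_n^Q=\{\pi\in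 S_n: ND(\pi)=Q\}$. The set of dominant cells is the same for all $\pi\in S_n^Q$; removing from it all cells lying in a row or column that contains an element of $Q$, and renumbering the remaining rows and columns in increasing order, yields a Ferrers board $\lambda(Q)$: a board $\lambda=(\lambda_1,\ldots,\lambda_k)$, $\lambda_1\ge\cdots\ge\lambda_k$, whose row $i$ (from the bottom) consists of the cells in columns $1,\ldots,\lambda_i$. A filling of $\lambda$ is a placement of crosses in cells of $\lambda$ with exactly one cross in each of its $k$ rows and each of its columns; $S_\lambda$ is the set of fillings. For a filling $\pi$: $\pi$ has a $1\underline{2}$-match at column $t$ if there is a cross in a cell $(c,r)$ and the cross of column $t$ is in $(t,r')$ with $c<t$, $r<r'$, and all four cells $(c,r),(c,r'),(t,r),(t,r')$ lie in $\lambda$; $\pi$ has a $\underline{2}1$-match at column $t$ if the cross of column $t$ is in $(t,r')$ and there is a cross in $(c,r)$ with $t<c$, $r<r'$, and all four cells $(t,r),(t,r'),(c,r),(c,r')$ lie in $\lambda$. $pmp_{1\underline{2}}(\pi)$, $pmp_{\underline{2}1}(\pi)$ count the columns with such a match. -}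

module Defs where

open import Data.Bool using (Bool; true; false; _∧_; _∨_; not; T)
open import Data.Nat using (ℕ; zero; suc; _+_; _∸_; _≡ᵇ_; _<ᵇ_; _≤ᵇ_; _≟_)
open import Data.List using (List; []; _∷_; length; map; filterᵇ; applyUpTo; concatMap)
open import Data.Bool.ListAction using (all; any)
open import Data.List.Properties using (≡-dec)
open import Relation.Nullary.Decidable using (⌊_⌋)

-- Conventions: everything is 1-based as in the paper.  A word / permutation
-- is a List ℕ; its a-th entry (a = 1,2,...) is  at w a.

range : ℕ → ℕ → List ℕ
range a n = applyUpTo (a +_) n

-- 1-based lookup (0 outside the word)
at : List ℕ → ℕ → ℕ
at []       _             = 0
at (x ∷ xs) zero          = 0
at (x ∷ xs) (suc zero)    = x
at (x ∷ xs) (suc (suc i)) = at xs (suc i)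

inRange : ℕ → ℕ → ℕ → Bool
inRange lo hi v = (lo ≤ᵇ v) ∧ (v ≤ᵇ hi)

elemᵇ : ℕ → List ℕ → Bool
elemᵇ v w = any (v ≡ᵇ_) w

_==L_ : List ℕ → List ℕ → Bool
u ==L v = ⌊ ≡-dec _≟_ u v ⌋

countᵇ : {A : Set} → (A → Bool) → List A → ℕ
countᵇ p xs = length (filterᵇ p xs)

red : List ℕ → List ℕ
red w = map (λ x → suc (countᵇ (λ y → y <ᵇ x) w)) w

words : ℕ → ℕ → List (List ℕ)
words n zero      = [] ∷ []
words n (suc len) = concatMap (λ v → map (v ∷_) (words n len)) (range 1 n)

-- w is a permutation of [n] (one-line notation): length n and every
-- value 1..n occurs (hence each exactly once)
isPerm : ℕ → List ℕ → Bool
isPerm n w = (length w ≡ᵇ n) ∧ all (λ v → elemᵇ v w) (range 1 n)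

Sn : ℕ → List (List ℕ)
Sn n = filterᵇ (isPerm n) (words n n)

increasing : List ℕ → Bool
increasing []           = true
increasing (x ∷ [])     = true
increasing (x ∷ y ∷ xs) = (x <ᵇ y) ∧ increasing (y ∷ xs)

incSeqs : ℕ → ℕ → List (List ℕ)
incSeqs n k = filterᵇ increasing (words n k)

-- Positional marked patterns.  A pattern is given by its underlying
-- permutation ρ (one-line, 1-based) and the underlined position u.

pmMatch : List ℕ → ℕ → List ℕ → ℕ → Bool
pmMatch ρ u σ ℓ =
  any (λ is → (at is u ≡ᵇ ℓ) ∧ (red (map (at σ) is) ==L ρ))
      (incSeqs (length σ) (length ρ))

pmp : List ℕ → ℕ → List ℕ → ℕ
pmp ρ u σ = countᵇ (pmMatch ρ u σ) (range 1 (length σ))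

-- P₁ = 1 \underline{2} p₁⋯p_{m-2}  (underlined position 2)
-- P₂ = \underline{2} 1 p₁⋯p_{m-2}  (underlined position 1)
P₁ : List ℕ → List ℕ
P₁ p = 1 ∷ 2 ∷ p

P₂ : List ℕ → List ℕ
P₂ p = 2 ∷ 1 ∷ p

-- Cell (a,b) (column a, row b) of the diagram of π is dominant if there
-- are columns a < c₁ < ⋯ < c_{m-2} with π_{c_j} > b and
-- red(π_{c₁}⋯π_{c_{m-2}}) = τ.
dominant : List ℕ → List ℕ → ℕ → ℕ → Bool
dominant τ π a b =
  any (λ cs → (a <ᵇ at cs 1) ∧ all (λ c → b <ᵇ at π c) cs
              ∧ (red (map (at π) cs) ==L τ))
      (incSeqs (length π) (length τ))

inND : List ℕ → List ℕ → ℕ → ℕ → Bool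
inND τ π a b =
  inRange 1 (length π) a ∧ (at π a ≡ᵇ b) ∧ not (dominant τ π a b)

-- Subsets Q of ℕ×ℕ are given by their (decidable) membership predicate.
Cells : Set
Cells = ℕ → ℕ → Bool

_⊆grid_ : Cells → ℕ → Set
Q ⊆grid n = ∀ a b → T (Q a b) → T (inRange 1 n a ∧ inRange 1 n b)

inSnQ : List ℕ → Cells → ℕ → List ℕ → Bool
inSnQ τ Q n π =
  isPerm n π ∧
  all (λ a → all (λ b → ⌊ Data.Bool._≟_ (Q a b) (inND τ π a b) ⌋) (range 1 n))
      (range 1 n)
  where import Data.Bool

SnQ : List ℕ → Cells → ℕ → List (List ℕ)
SnQ τ Q n = filterᵇ (inSnQ τ Q n) (Sn n)

-- The Ferrers board λ(Q), computed from the (common) set of dominant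
-- cells of an element π₀ ∈ S_n^Q: delete every row and column containing
-- an element of Q, renumber remaining rows/columns increasingly;
-- λ_j = number of remaining dominant cells in the j-th remaining row
-- (row 1 = bottom).
rowHasQ : Cells → ℕ → ℕ → Bool
rowHasQ Q n b = any (λ a → Q a b) (range 1 n)

colHasQ : Cells → ℕ → ℕ → Bool
colHasQ Q n a = any (λ b → Q a b) (range 1 n)

remRows : Cells → ℕ → List ℕ
remRows Q n = filterᵇ (λ b → not (rowHasQ Q n b)) (range 1 n)

remCols : Cells → ℕ → List ℕ
remCols Q n = filterᵇ (λ a → not (colHasQ Q n a)) (range 1 n)

lambdaQ : List ℕ → Cells → ℕ → List ℕ → List ℕ
lambdaQ τ Q n π₀ =
  map (λ b → countᵇ (λ a → dominant τ π₀ a b) (remCols Q n)) (remRows Q n)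

-- Ferrers boards λ = (λ₁ ≥ ⋯ ≥ λ_k): row i (from bottom) has columns 1..λ_i.
inBoard : List ℕ → ℕ → ℕ → Bool
inBoard lam c r = inRange 1 (length lam) r ∧ inRange 1 (at lam r) c

ncols : List ℕ → ℕ
ncols []      = 0
ncols (l ∷ _) = l

-- Fillings of λ: σ lists, for each column c = 1..λ₁, the row σ_c of its
-- cross; exactly one cross per row and per column, all crosses in λ.
fillings : List ℕ → List (List ℕ)
fillings lam =
  filterᵇ (λ σ → isPerm (length lam) σ
                 ∧ all (λ c → inBoard lam c (at σ c)) (range 1 (ncols lam)))
          (words (length lam) (ncols lam))

match12 : List ℕ → List ℕ → ℕ → Bool
match12 lam σ t =
  any (λ c → (c <ᵇ t) ∧ (at σ c <ᵇ at σ t)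
             ∧ inBoard lam c (at σ c) ∧ inBoard lam c (at σ t)
             ∧ inBoard lam t (at σ c) ∧ inBoard lam t (at σ t))
      (range 1 (length σ))

match21 : List ℕ → List ℕ → ℕ → Bool
match21 lam σ t =
  any (λ c → (t <ᵇ c) ∧ (at σ c <ᵇ at σ t)
             ∧ inBoard lam t (at σ c) ∧ inBoard lam t (at σ t)
             ∧ inBoard lam c (at σ c) ∧ inBoard lam c (at σ t))
      (range 1 (length σ))

pmp12 : List ℕ → List ℕ → ℕ
pmp12 lam σ = countᵇ (match12 lam σ) (range 1 (length σ))

pmp21 : List ℕ → List ℕ → ℕ
pmp21 lam σ = countᵇ (match21 lam σ) (range 1 (length σ))

-- Generating polynomial  Σ_{a ∈ xs} x^{stat a}, represented by its
-- coefficient sequence: coefficient of x^k = #{a ∈ xs | stat a = k}.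
-- Two such polynomials are equal iff all coefficients agree.
genPoly : {A : Set} → List A → (A → ℕ) → ℕ → ℕ
genPoly xs stat k = countᵇ (λ a → stat a ≡ᵇ k) xs

-- Every cross of π ∈ S_n^Q outside Q is dominant, while the crosses in Q are not.  A dominant cell
-- always has a witness whose columns carry crosses in Q: if a witness column carries a cross outside
-- Q, that cross is dominant and its own witness, further up and to the right, serves instead.  As all
-- π ∈ S_n^Q share their crosses in Q, they share their dominant cells, which form a down-closed set;
-- so deleting the rows and columns of Q is a bijection from S_n^Q onto the fillings of λ(Q).
-- An occurrence of P₁ (resp. P₂) marked at column ℓ consists of a smaller entry to the left (resp.
-- right) of ℓ together with an occurrence of τ above and to the right of the cell (ℓ, π_ℓ) (resp.
-- (c, π_ℓ), c the column of the smaller entry), i.e. dominance of that cell.  By down-closure this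
-- is exactly a 1̲2-match (resp. 2̲1-match) of the compressed filling, and ℓ is necessarily a free
-- column, so the bijection carries pmp_{P₁} to pmp_{1̲2} and pmp_{P₂} to pmp_{2̲1}.

module Submission where

open import Defs
import Data.Bool as Bool
open import Data.Bool using (Bool; true; false; _∧_; not; T; if_then_else_)
open import Data.Bool.Properties using (T-∧; T?)
open import Data.Bool.ListAction using (all; any)
open import Data.Empty using (⊥-elim)
import Data.Nat
open import Data.Nat using (ℕ; zero; suc; _+_; _∸_; _≡ᵇ_; _<ᵇ_; _≤ᵇ_; _≤_; _<_; z≤n; s≤s; _<?_; _≟_)
open import Data.Nat.Properties
open import Data.List using (List; []; _∷_; _++_; length; map; filterᵇ; applyUpTo)
open import Data.List.Properties
  using ( ≡-dec; ∷-injective; map-∘; map-id-local; map-cong-local; map-injective; length-applyUpTo; length-map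
        ; length-filter; filter-all; filter-none; filter-accept; filter-reject)
open import Data.List.Membership.Propositional using (_∈_; _∉_; lose; find)
open import Data.List.Membership.DecPropositional Data.Nat._≟_ using (_∈?_)
open import Data.List.Membership.Propositional.Properties
  using ( ∈-∃++; ∈-++⁺ʳ; ∈-map⁺; ∈-map⁻; ∈-filter⁺; ∈-filter⁻; ∈-concat⁺′; ∈-concat⁻′
        ; ∈-applyUpTo⁺; ∈-applyUpTo⁻)
open import Data.List.Relation.Unary.Any using (here; there)
open import Data.List.Relation.Unary.All as All using (All; []; _∷_)
import Data.List.Relation.Unary.All.Properties as AllP
open import Data.List.Relation.Unary.Any.Properties using (any⁺; any⁻)
open import Data.List.Relation.Unary.AllPairs as AllPairs using (AllPairs; []; _∷_)
import Data.List.Relation.Unary.AllPairs.Properties as AllPairsP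
open import Data.List.Relation.Unary.Unique.Propositional using (Unique)
import Data.List.Relation.Unary.Unique.Propositional.Properties as UniqueP
open import Data.List.Relation.Binary.Disjoint.Propositional using (Disjoint)
open import Data.List.Relation.Binary.Permutation.Propositional using (_↭_)
open import Data.List.Relation.Binary.Permutation.Propositional.Properties using (↭-length; filter-↭; ∈-resp-↭)
open import Data.Product using (∃; _×_; _,_; proj₁; proj₂)
open import Data.Sum using (_⊎_; inj₁; inj₂)
open import Function using (_∘_)
open import Function.Bundles using (Equivalence)
open import Relation.Binary using (tri<; tri≈; tri>)
open import Relation.Nullary using (¬_; yes; no)
open import Relation.Nullary.Decidable using (toWitness; fromWitness)
open import Relation.Binary.PropositionalEquality

T-∧⁺ : ∀ {a b} → T a → T b → T (a ∧ b)
T-∧⁺ x y = Equivalence.from T-∧ (x , y)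

T-∧⁻ : ∀ {a b} → T (a ∧ b) → T a × T b
T-∧⁻ {a} = Equivalence.to (T-∧ {a})

T-not⁺ : ∀ {a} → ¬ T a → T (not a)
T-not⁺ {false} _ = _
T-not⁺ {true}  f = f _

T-not⁻ : ∀ {a} → T (not a) → ¬ T a
T-not⁻ {false} _ ()

T-injective : ∀ {a b} → (T a → T b) → (T b → T a) → a ≡ b
T-injective {false} {false} _ _ = refl
T-injective {false} {true}  _ g = ⊥-elim (g _)
T-injective {true}  {false} f _ = ⊥-elim (f _)
T-injective {true}  {true}  _ _ = refl

T-∧⁶⁺ : ∀ {a b c d e f} → T a → T b → T c → T d → T e → T f → T (a ∧ b ∧ c ∧ d ∧ e ∧ f)
T-∧⁶⁺ {true} {true} {true} {true} {true} {true} _ _ _ _ _ _ = _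

T-∧⁶⁻ : ∀ a b c d e f → T (a ∧ b ∧ c ∧ d ∧ e ∧ f) → T a × T b × T c × T d × T e × T f
T-∧⁶⁻ true true true true true true _ = _ , _ , _ , _ , _ , _

module _ {A : Set} (p : A → Bool) where

  ∈⇒any : ∀ {x xs} → x ∈ xs → T (p x) → T (any p xs)
  ∈⇒any x∈xs px = any⁺ p (lose x∈xs px)

  any⇒∈ : ∀ xs → T (any p xs) → ∃ λ x → x ∈ xs × T (p x)
  any⇒∈ xs t = find (any⁻ p xs t)

  ∈⇒all : ∀ xs → (∀ {x} → x ∈ xs → T (p x)) → T (all p xs)
  ∈⇒all xs f = AllP.all⁻ p (All.tabulate f)

  all⇒∈ : ∀ xs → T (all p xs) → ∀ {x} → x ∈ xs → T (p x)
  all⇒∈ xs t = All.lookup (AllP.all⁺ p xs t)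

  ∈-filterᵇ⁺ : ∀ {x xs} → x ∈ xs → T (p x) → x ∈ filterᵇ p xs
  ∈-filterᵇ⁺ = ∈-filter⁺ (T? ∘ p)

  ∈-filterᵇ⁻ : ∀ xs {x} → x ∈ filterᵇ p xs → x ∈ xs × T (p x)
  ∈-filterᵇ⁻ xs = ∈-filter⁻ (T? ∘ p) {xs = xs}

module _ {A : Set} where

  countᵇ-cong : ∀ (p q : A → Bool) xs → (∀ {x} → x ∈ xs → p x ≡ q x) → countᵇ p xs ≡ countᵇ q xs
  countᵇ-cong p q []       _ = refl
  countᵇ-cong p q (y ∷ ys) f with p y | q y | f (here refl)
  ... | true  | true  | _ = cong suc (countᵇ-cong p q ys (f ∘ there))
  ... | false | false | _ = countᵇ-cong p q ys (f ∘ there)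

  countᵇ-↭ : ∀ (p : A → Bool) {xs ys} → xs ↭ ys → countᵇ p xs ≡ countᵇ p ys
  countᵇ-↭ p xs↭ys = ↭-length (filter-↭ (T? ∘ p) xs↭ys)

  countᵇ-all : ∀ (p : A → Bool) xs → (∀ {x} → x ∈ xs → T (p x)) → countᵇ p xs ≡ length xs
  countᵇ-all p xs f = cong length (filter-all (T? ∘ p) (All.tabulate f))

  countᵇ≤length : ∀ (p : A → Bool) xs → countᵇ p xs ≤ length xs
  countᵇ≤length p = length-filter (T? ∘ p)

  countᵇ-filterᵇ : ∀ (p q : A → Bool) xs → (∀ {x} → x ∈ xs → T (p x) → T (q x))
                 → countᵇ p xs ≡ countᵇ p (filterᵇ q xs)
  countᵇ-filterᵇ p q []       _ = refl
  countᵇ-filterᵇ p q (y ∷ ys) f with q y in qy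
  ... | true with p y
  ...   | true  = cong suc (countᵇ-filterᵇ p q ys (f ∘ there))
  ...   | false = countᵇ-filterᵇ p q ys (f ∘ there)
  countᵇ-filterᵇ p q (y ∷ ys) f | false with p y in py
  ...   | true  = ⊥-elim (subst T qy (f (here refl) (subst T (sym py) _)))
  ...   | false = countᵇ-filterᵇ p q ys (f ∘ there)

countᵇ-map : ∀ {A B : Set} (p : B → Bool) (f : A → B) xs → countᵇ p (map f xs) ≡ countᵇ (p ∘ f) xs
countᵇ-map p f []       = refl
countᵇ-map p f (y ∷ ys) with p (f y)
... | true  = cong suc (countᵇ-map p f ys)
... | false = countᵇ-map p f ys

module _ {A : Set} {v : A} where

  length-++-∷ : ∀ as {bs} → length (as ++ v ∷ bs) ≡ suc (length (as ++ bs))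
  length-++-∷ []       = refl
  length-++-∷ (a ∷ as) = cong suc (length-++-∷ as)

  ∈-++-∷⁺ : ∀ {y} as {bs} → y ∈ as ++ bs → y ∈ as ++ v ∷ bs
  ∈-++-∷⁺ []       y∈          = there y∈
  ∈-++-∷⁺ (a ∷ as) (here refl) = here refl
  ∈-++-∷⁺ (a ∷ as) (there y∈)  = there (∈-++-∷⁺ as y∈)

  ∈-++-∷⁻ : ∀ {y} as {bs} → y ∈ as ++ v ∷ bs → y ≢ v → y ∈ as ++ bs
  ∈-++-∷⁻ []       (here refl) y≢v = ⊥-elim (y≢v refl)
  ∈-++-∷⁻ []       (there y∈)  _   = y∈
  ∈-++-∷⁻ (a ∷ as) (here refl) _   = here refl
  ∈-++-∷⁻ (a ∷ as) (there y∈)  y≢v = there (∈-++-∷⁻ as y∈ y≢v)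

  unique-++-∷ : ∀ as {bs} → Unique (as ++ v ∷ bs) → Unique (as ++ bs) × v ∉ as ++ bs
  unique-++-∷ []       (v∉ ∷ !bs) = !bs , λ v∈ → All.lookup v∉ v∈ refl
  unique-++-∷ (a ∷ as) (a∉ ∷ !r)  =
    let (!r′ , v∉) = unique-++-∷ as !r in
    All.tabulate (All.lookup a∉ ∘ ∈-++-∷⁺ as) ∷ !r′ ,
    λ { (here refl) → All.lookup a∉ (∈-++⁺ʳ as (here refl)) refl ; (there v∈) → v∉ v∈ }

InjectiveOn : ∀ {A B : Set} → (A → B) → List A → Set
InjectiveOn f xs = ∀ {x y} → x ∈ xs → y ∈ xs → f x ≡ f y → x ≡ y

length≤-by-injection : ∀ {A B : Set} (f : A → B) xs ys → Unique xs
  → (∀ {x} → x ∈ xs → f x ∈ ys) → InjectiveOn f xs → length xs ≤ length ys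
length≤-by-injection f []       ys _            _    _   = z≤n
length≤-by-injection f (x ∷ xs) ys (x∉xs ∷ !xs) into inj
  with as , bs , refl ← ∈-∃++ (into (here refl)) =
  subst (suc (length xs) ≤_) (sym (length-++-∷ as))
    (s≤s (length≤-by-injection f xs (as ++ bs) !xs
      (λ y∈xs → ∈-++-∷⁻ as (into (there y∈xs))
                  (λ e → All.lookup x∉xs y∈xs (inj (here refl) (there y∈xs) (sym e))))
      (λ y∈ z∈ → inj (there y∈) (there z∈))))

retraction⇒injectiveOn : ∀ {A B : Set} (f : A → B) (g : B → A) xs
                       → (∀ {x} → x ∈ xs → g (f x) ≡ x) → InjectiveOn f xs
retraction⇒injectiveOn f g xs gf x∈ y∈ e = trans (sym (gf x∈)) (trans (cong g e) (gf y∈))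

genPoly-≤-by-injection : ∀ {A B : Set} (xs : List A) (ys : List B) (f : A → B) → Unique xs
  → (∀ {x} → x ∈ xs → f x ∈ ys) → InjectiveOn f xs
  → (s : A → ℕ) (t : B → ℕ) → (∀ {x} → x ∈ xs → t (f x) ≡ s x)
  → ∀ k → genPoly xs s k ≤ genPoly ys t k
genPoly-≤-by-injection xs ys f !xs f∈ inj s t t∘f≡s k =
  length≤-by-injection f (filterᵇ Sₖ xs) (filterᵇ Tₖ ys) (UniqueP.filter⁺ (T? ∘ Sₖ) !xs)
    (λ x∈ → let (x∈xs , sx≡k) = ∈-filterᵇ⁻ Sₖ xs x∈ in
       ∈-filterᵇ⁺ Tₖ (f∈ x∈xs) (subst (λ z → T (z ≡ᵇ k)) (sym (t∘f≡s x∈xs)) sx≡k))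
    (λ x∈ y∈ → inj (proj₁ (∈-filterᵇ⁻ Sₖ xs x∈)) (proj₁ (∈-filterᵇ⁻ Sₖ xs y∈)))
  where
  Sₖ = λ a → s a ≡ᵇ k
  Tₖ = λ b → t b ≡ᵇ k

genPoly-bijection : ∀ {A B : Set} (xs : List A) (ys : List B) (f : A → B) (g : B → A)
  → Unique xs → Unique ys
  → (∀ {x} → x ∈ xs → f x ∈ ys) → (∀ {y} → y ∈ ys → g y ∈ xs)
  → (∀ {x} → x ∈ xs → g (f x) ≡ x) → (∀ {y} → y ∈ ys → f (g y) ≡ y)
  → (s : A → ℕ) (t : B → ℕ) → (∀ {x} → x ∈ xs → t (f x) ≡ s x)
  → ∀ k → genPoly xs s k ≡ genPoly ys t k
genPoly-bijection xs ys f g !xs !ys f∈ g∈ gf fg s t t∘f≡s k = ≤-antisym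
  (genPoly-≤-by-injection xs ys f !xs f∈ (retraction⇒injectiveOn f g xs gf) s t t∘f≡s k)
  (genPoly-≤-by-injection ys xs g !ys g∈ (retraction⇒injectiveOn g f ys fg) t s
     (λ y∈ → trans (sym (t∘f≡s (g∈ y∈))) (cong t (fg y∈))) k)

Pos : ℕ → ℕ → Set
Pos n i = 1 ≤ i × i ≤ n

∈-range⁻ : ∀ a n {x} → x ∈ range a n → a ≤ x × x < a + n
∈-range⁻ a n x∈ with i , i<n , refl ← ∈-applyUpTo⁻ (a +_) x∈ = m≤m+n a i , +-monoʳ-< a i<n

∈-range1⁻ : ∀ n {x} → x ∈ range 1 n → Pos n x
∈-range1⁻ n x∈ = let (1≤x , x<1+n) = ∈-range⁻ 1 n x∈ in 1≤x , ≤-pred x<1+n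

∈-range1⁺ : ∀ n {x} → Pos n x → x ∈ range 1 n
∈-range1⁺ n {suc x} (_ , x<n) = ∈-applyUpTo⁺ (1 +_) x<n

inRange⁻ : ∀ n {v} → T (inRange 1 n v) → Pos n v
inRange⁻ n {v} t = let (1≤v , v≤n) = T-∧⁻ {1 ≤ᵇ v} t in ≤ᵇ⇒≤ 1 v 1≤v , ≤ᵇ⇒≤ v n v≤n

inRange⁺ : ∀ n {v} → Pos n v → T (inRange 1 n v)
inRange⁺ n (1≤v , v≤n) = T-∧⁺ (≤⇒≤ᵇ 1≤v) (≤⇒≤ᵇ v≤n)

range-sorted : ∀ a n → AllPairs _<_ (range a n)
range-sorted a n = AllPairsP.applyUpTo⁺₁ (a +_) n (λ i<j _ → +-monoʳ-< a i<j)

length-range : ∀ a n → length (range a n) ≡ n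
length-range a = length-applyUpTo (a +_)

range-suc : ∀ a n → range a (suc n) ≡ a ∷ range (suc a) n
range-suc a n = cong₂ _∷_ (+-identityʳ a) (shift (a +_) (suc a +_) n (+-suc a))
  where
  shift : ∀ (f g : ℕ → ℕ) n → (∀ i → f (suc i) ≡ g i) → applyUpTo (f ∘ suc) n ≡ applyUpTo g n
  shift f g zero    _ = refl
  shift f g (suc n) e = cong₂ _∷_ (e 0) (shift (f ∘ suc) (g ∘ suc) n (e ∘ suc))

sorted⇒unique : ∀ {xs} → AllPairs _<_ xs → Unique xs
sorted⇒unique = AllPairs.map (λ x<y x≡y → <-irrefl x≡y x<y)

at-∈ : ∀ xs {i} → Pos (length xs) i → at xs i ∈ xs
at-∈ (x ∷ xs) {suc zero}    _             = here refl
at-∈ (x ∷ xs) {suc (suc i)} (_ , s≤s i≤n) = there (at-∈ xs (s≤s z≤n , i≤n))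

∈⇒at : ∀ xs {x} → x ∈ xs → ∃ λ i → Pos (length xs) i × at xs i ≡ x
∈⇒at (y ∷ ys) (here refl) = 1 , (s≤s z≤n , s≤s z≤n) , refl
∈⇒at (y ∷ ys) (there x∈)
  with suc i , (_ , i≤n) , e ← ∈⇒at ys x∈ = suc (suc i) , (s≤s z≤n , s≤s i≤n) , e

at-map : ∀ (f : ℕ → ℕ) xs {i} → Pos (length xs) i → at (map f xs) i ≡ f (at xs i)
at-map f (x ∷ xs) {suc zero}    _             = refl
at-map f (x ∷ xs) {suc (suc i)} (_ , s≤s i≤n) = at-map f xs (s≤s z≤n , i≤n)

at-range : ∀ a n {i} → Pos n i → at (range a n) i ≡ a + (i ∸ 1)
at-range a (suc n) {suc zero}    _             = refl
at-range a (suc n) {suc (suc i)} (_ , s≤s i≤n) = begin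
  at (range a (suc n)) (suc (suc i)) ≡⟨ cong (λ l → at l (suc (suc i))) (range-suc a n) ⟩
  at (range (suc a) n) (suc i)       ≡⟨ at-range (suc a) n (s≤s z≤n , i≤n) ⟩
  suc a + i                          ≡⟨ +-suc a i ⟨
  a + suc i                          ∎
  where open ≡-Reasoning

at-map-range : ∀ (f : ℕ → ℕ) n {i} → Pos n i → at (map f (range 1 n)) i ≡ f i
at-map-range f n {suc i} i∈@(_ , i≤n) =
  trans (at-map f (range 1 n) (proj₁ i∈ , subst (suc i ≤_) (sym (length-range 1 n)) i≤n))
        (cong f (at-range 1 n i∈))

length-map-range : ∀ (f : ℕ → ℕ) n → length (map f (range 1 n)) ≡ n
length-map-range f n = trans (length-map f (range 1 n)) (length-range 1 n)

at-ext : ∀ xs ys → length xs ≡ length ys → (∀ {i} → Pos (length xs) i → at xs i ≡ at ys i) → xs ≡ ys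
at-ext []       []       _ _ = refl
at-ext (x ∷ xs) (y ∷ ys) e f = cong₂ _∷_ (f (s≤s z≤n , s≤s z≤n))
  (at-ext xs ys (suc-injective e) λ { {suc i} (_ , i≤n) → f (s≤s z≤n , s≤s i≤n) })

map-at-range : ∀ xs → map (at xs) (range 1 (length xs)) ≡ xs
map-at-range xs = at-ext _ xs (length-map-range (at xs) (length xs)) λ {i} (1≤i , i≤) →
  at-map-range (at xs) (length xs) (1≤i , subst (i ≤_) (length-map-range (at xs) (length xs)) i≤)

countᵇ-by-position : ∀ (p : ℕ → Bool) xs → countᵇ p xs ≡ countᵇ (p ∘ at xs) (range 1 (length xs))
countᵇ-by-position p xs = trans (cong (countᵇ p) (sym (map-at-range xs))) (countᵇ-map p (at xs) (range 1 (length xs)))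

at-mono : ∀ xs {i j} → AllPairs _<_ xs → 1 ≤ i → i < j → j ≤ length xs → at xs i < at xs j
at-mono (x ∷ xs) {suc zero}    {suc zero}    _ _ (s≤s ()) _
at-mono (x ∷ xs) {suc zero}    {suc (suc j)} (x< ∷ _) _ _ (s≤s j≤n) = All.lookup x< (at-∈ xs (s≤s z≤n , j≤n))
at-mono (x ∷ xs) {suc (suc i)} {suc (suc j)} (_ ∷ s) _ (s≤s i<j) (s≤s j≤n) = at-mono xs s (s≤s z≤n) i<j j≤n

at-mono-≤ : ∀ xs {i j} → AllPairs _<_ xs → 1 ≤ i → i ≤ j → j ≤ length xs → at xs i ≤ at xs j
at-mono-≤ xs s 1≤i i≤j j≤n with m≤n⇒m<n∨m≡n i≤j
... | inj₁ i<j  = <⇒≤ (at-mono xs s 1≤i i<j j≤n)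
... | inj₂ refl = ≤-refl

at-cancel-< : ∀ xs {i j} → AllPairs _<_ xs → Pos (length xs) i → Pos (length xs) j → at xs i < at xs j → i < j
at-cancel-< xs {i} {j} s i∈ j∈ lt with <-cmp i j
... | tri< i<j _ _ = i<j
... | tri≈ _ refl _ = ⊥-elim (<-irrefl refl lt)
... | tri> _ _ j<i = ⊥-elim (<-asym lt (at-mono xs s (proj₁ j∈) j<i (proj₂ i∈)))

at-injective : ∀ xs {i j} → Unique xs → Pos (length xs) i → Pos (length xs) j → at xs i ≡ at xs j → i ≡ j
at-injective (x ∷ xs) {suc zero}    {suc zero}    _         _ _ _ = refl
at-injective (x ∷ xs) {suc zero}    {suc (suc j)} (x∉ ∷ _) _ (_ , s≤s j≤n) e =
  ⊥-elim (All.lookup x∉ (at-∈ xs (s≤s z≤n , j≤n)) e)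
at-injective (x ∷ xs) {suc (suc i)} {suc zero}    (x∉ ∷ _) (_ , s≤s i≤n) _ e =
  ⊥-elim (All.lookup x∉ (at-∈ xs (s≤s z≤n , i≤n)) (sym e))
at-injective (x ∷ xs) {suc (suc i)} {suc (suc j)} (_ ∷ !xs) (_ , s≤s i≤n) (_ , s≤s j≤n) e =
  cong suc (at-injective xs !xs (s≤s z≤n , i≤n) (s≤s z≤n , j≤n) e)

position : ℕ → List ℕ → ℕ
position v []      = 0
position v (x ∷ l) with v ≡ᵇ x
... | true  = 1
... | false = suc (position v l)

position-∈ : ∀ {v} l → v ∈ l → Pos (length l) (position v l) × at l (position v l) ≡ v
position-∈ {v} (x ∷ l) v∈ with v ≡ᵇ x in v≡x
... | true = (s≤s z≤n , s≤s z≤n) , sym (≡ᵇ⇒≡ v x (subst T (sym v≡x) _))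
... | false with v∈
...   | here refl = ⊥-elim (subst T v≡x (≡⇒≡ᵇ v v refl))
...   | there v∈l with position v l | position-∈ l v∈l
...     | suc i | (_ , i≤n) , e = (s≤s z≤n , s≤s i≤n) , e

position-at : ∀ l {i} → Unique l → Pos (length l) i → position (at l i) l ≡ i
position-at l !l i∈ = let (p∈ , e) = position-∈ l (at-∈ l i∈) in at-injective l !l p∈ i∈ e

∈-words⁻ : ∀ n k {xs} → xs ∈ words n k → length xs ≡ k × All (Pos n) xs
∈-words⁻ n zero    (here refl) = refl , []
∈-words⁻ n (suc k) xs∈
  with ys , ys∈ , v∈ ← ∈-concat⁻′ (map (λ v → map (v ∷_) (words n k)) (range 1 n)) xs∈
  with v , v∈n , refl ← ∈-map⁻ (λ v → map (v ∷_) (words n k)) v∈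
  with zs , zs∈ , refl ← ∈-map⁻ (v ∷_) ys∈
  = let (len , pos) = ∈-words⁻ n k zs∈ in cong suc len , ∈-range1⁻ n v∈n ∷ pos

∈-words⁺ : ∀ n k {xs} → length xs ≡ k → All (Pos n) xs → xs ∈ words n k
∈-words⁺ n zero    {[]}     refl []         = here refl
∈-words⁺ n (suc k) {x ∷ xs} len  (x∈ ∷ xs∈) =
  ∈-concat⁺′ (∈-map⁺ (x ∷_) (∈-words⁺ n k (suc-injective len) xs∈))
             (∈-map⁺ (λ v → map (v ∷_) (words n k)) (∈-range1⁺ n x∈))

words-unique : ∀ n k → Unique (words n k)
words-unique n zero    = [] ∷ []
words-unique n (suc k) =
  UniqueP.concat⁺ (AllP.map⁺ (All.universal (λ v → UniqueP.map⁺ (cong tail) (words-unique n k)) _))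
                  (AllPairsP.map⁺ (AllPairs.map disjoint (range-sorted 1 n)))
  where
  tail : List ℕ → List ℕ
  tail []       = []
  tail (_ ∷ xs) = xs
  head : List ℕ → ℕ
  head []      = 0
  head (x ∷ _) = x
  disjoint : ∀ {v w} → v < w → Disjoint (map (v ∷_) (words n k)) (map (w ∷_) (words n k))
  disjoint {v} {w} v<w (xs∈v , xs∈w)
    with _ , _ , refl ← ∈-map⁻ (v ∷_) xs∈v | _ , _ , e ← ∈-map⁻ (w ∷_) xs∈w = <-irrefl (cong head e) v<w

isPerm⁻ : ∀ n xs → T (isPerm n xs) → length xs ≡ n × (∀ {v} → Pos n v → v ∈ xs)
isPerm⁻ n xs t = let (len , covers) = T-∧⁻ {length xs ≡ᵇ n} t in ≡ᵇ⇒≡ _ _ len , λ {v} v∈ →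
  let (y , y∈ , v≡y) = any⇒∈ (v ≡ᵇ_) xs (all⇒∈ _ (range 1 n) covers (∈-range1⁺ n v∈))
  in subst (_∈ xs) (sym (≡ᵇ⇒≡ v y v≡y)) y∈

isPerm⁺ : ∀ n xs → length xs ≡ n → (∀ {v} → Pos n v → v ∈ xs) → T (isPerm n xs)
isPerm⁺ n xs len covers = T-∧⁺ (≡⇒≡ᵇ _ _ len)
  (∈⇒all _ (range 1 n) (λ {v} v∈ → ∈⇒any _ (covers (∈-range1⁻ n v∈)) (≡⇒≡ᵇ v v refl)))

covering⇒unique : ∀ (xs ys : List ℕ) → Unique ys → (∀ {y} → y ∈ ys → y ∈ xs) → length xs ≤ length ys
                → Unique xs × (∀ {x} → x ∈ xs → x ∈ ys)
covering⇒unique []       ys _   _      _ = [] , λ ()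
covering⇒unique (x ∷ xs) ys !ys ys⊆ len with x ∈? ys
... | no x∉ys = ⊥-elim (<-irrefl refl (≤-trans len
      (length≤-by-injection (λ z → z) ys xs !ys ys⊆xs (λ _ _ e → e))))
  where
  ys⊆xs : ∀ {y} → y ∈ ys → y ∈ xs
  ys⊆xs y∈ with ys⊆ y∈
  ... | here refl = ⊥-elim (x∉ys y∈)
  ... | there y∈xs = y∈xs
... | yes x∈ys with as , bs , refl ← ∈-∃++ x∈ys =
  let (!rest , x∉rest) = unique-++-∷ as !ys
      (!xs , xs⊆) = covering⇒unique xs (as ++ bs) !rest rest⊆xs
                      (≤-pred (subst (suc (length xs) ≤_) (length-++-∷ as) len))
  in All.tabulate (λ x′∈ x≡x′ → x∉rest (subst (_∈ as ++ bs) (sym x≡x′) (xs⊆ x′∈))) ∷ !xs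
   , λ { (here refl) → x∈ys ; (there x′∈) → ∈-++-∷⁺ as (xs⊆ x′∈) }
  where
  rest⊆xs : ∀ {y} → y ∈ as ++ bs → y ∈ xs
  rest⊆xs y∈ with ys⊆ (∈-++-∷⁺ as y∈)
  ... | here refl = ⊥-elim (proj₂ (unique-++-∷ as !ys) y∈)
  ... | there y∈xs = y∈xs

isPerm⇒unique : ∀ n xs → T (isPerm n xs) → Unique xs × All (Pos n) xs
isPerm⇒unique n xs t =
  let (len , covers) = isPerm⁻ n xs t
      (!xs , xs⊆) = covering⇒unique xs (range 1 n) (sorted⇒unique (range-sorted 1 n))
                      (covers ∘ ∈-range1⁻ n) (≤-reflexive (trans len (sym (length-range 1 n))))
  in !xs , All.tabulate (∈-range1⁻ n ∘ xs⊆)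

DownClosedAlong : (ℕ → Bool) → List ℕ → Set
DownClosedAlong q l = ∀ {i j} → 1 ≤ i → i ≤ j → j ≤ length l → T (q (at l j)) → T (q (at l i))

private
  DownClosedAlong-tail : ∀ q x l → DownClosedAlong q (x ∷ l) → DownClosedAlong q l
  DownClosedAlong-tail q x l dc {suc i} {suc j} _ i≤j j≤n = dc (s≤s z≤n) (s≤s i≤j) (s≤s j≤n)

at-prefix⁻ : ∀ q l → DownClosedAlong q l → ∀ {i} → 1 ≤ i → i ≤ countᵇ q l → T (q (at l i))
at-prefix⁻ q []      dc {suc i} _ ()
at-prefix⁻ q (x ∷ l) dc {i} 1≤i i≤c with q x in qx
at-prefix⁻ q (x ∷ l) dc {suc zero}    _ _         | true = subst T (sym qx) _
at-prefix⁻ q (x ∷ l) dc {suc (suc i)} _ (s≤s i≤c) | true =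
  at-prefix⁻ q l (DownClosedAlong-tail q x l dc) (s≤s z≤n) i≤c
at-prefix⁻ q (x ∷ l) dc {suc i}       _ i≤c       | false =
  ⊥-elim (subst T qx (dc (s≤s z≤n) (s≤s z≤n) (s≤s (≤-trans i≤c (countᵇ≤length q l)))
    (at-prefix⁻ q l (DownClosedAlong-tail q x l dc) (s≤s z≤n) i≤c)))

at-prefix⁺ : ∀ q l → DownClosedAlong q l → ∀ {i} → Pos (length l) i → T (q (at l i)) → i ≤ countᵇ q l
at-prefix⁺ q []      dc {suc i} (_ , ()) _
at-prefix⁺ q (x ∷ l) dc {i} (1≤i , i≤n) t with q x in qx | dc (s≤s z≤n) 1≤i i≤n t
... | false | ()
at-prefix⁺ q (x ∷ l) dc {suc zero}    _             _ | true | _ = s≤s z≤n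
at-prefix⁺ q (x ∷ l) dc {suc (suc i)} (_ , s≤s i≤n) t | true | _ =
  s≤s (at-prefix⁺ q l (DownClosedAlong-tail q x l dc) (s≤s z≤n , i≤n) t)

rank : ℕ → List ℕ → ℕ
rank x = countᵇ (_<ᵇ x)

rank-∷-< : ∀ {x y} l → y < x → rank x (y ∷ l) ≡ suc (rank x l)
rank-∷-< {x} l y<x = cong length (filter-accept (T? ∘ (_<ᵇ x)) (<⇒<ᵇ y<x))

rank-∷-≥ : ∀ {x y} l → x ≤ y → rank x (y ∷ l) ≡ rank x l
rank-∷-≥ {x} {y} l x≤y = cong length (filter-reject (T? ∘ (_<ᵇ x)) (λ t → <⇒≱ (<ᵇ⇒< y x t) x≤y))

rank-of-minimum : ∀ {x} l → All (x ≤_) l → rank x l ≡ 0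
rank-of-minimum {x} l x≤ = cong length (filter-none (T? ∘ (_<ᵇ x)) (All.map (λ x≤y t → <⇒≱ (<ᵇ⇒< _ x t) x≤y) x≤))

rank-mono : ∀ {x x′} l → x ≤ x′ → rank x l ≤ rank x′ l
rank-mono     []      _    = z≤n
rank-mono {x} {x′} (y ∷ l) x≤x′ with y <? x | y <? x′
... | yes y<x | _        = subst₂ _≤_ (sym (rank-∷-< l y<x)) (sym (rank-∷-< l (<-≤-trans y<x x≤x′)))
                             (s≤s (rank-mono l x≤x′))
... | no y≮x  | yes y<x′ = subst₂ _≤_ (sym (rank-∷-≥ l (≮⇒≥ y≮x))) (sym (rank-∷-< l y<x′))
                             (m≤n⇒m≤1+n (rank-mono l x≤x′))
... | no y≮x  | no y≮x′  = subst₂ _≤_ (sym (rank-∷-≥ l (≮⇒≥ y≮x))) (sym (rank-∷-≥ l (≮⇒≥ y≮x′)))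
                             (rank-mono l x≤x′)

rank-in-range : ∀ a k {x} → a ≤ x → x ≤ a + k → rank x (range a k) ≡ x ∸ a
rank-in-range a zero    {x} a≤x x≤a = sym (m≤n⇒m∸n≡0 (subst (x ≤_) (+-identityʳ a) x≤a))
rank-in-range a (suc k) {x} a≤x x≤a+k = trans (cong (rank x) (range-suc a k)) (split (m≤n⇒m<n∨m≡n a≤x))
  where
  open ≡-Reasoning
  split : a < x ⊎ a ≡ x → rank x (a ∷ range (suc a) k) ≡ x ∸ a
  split (inj₁ a<x) = begin
    rank x (a ∷ range (suc a) k)   ≡⟨ rank-∷-< (range (suc a) k) a<x ⟩
    suc (rank x (range (suc a) k)) ≡⟨ cong suc (rank-in-range (suc a) k a<x (subst (x ≤_) (+-suc a k) x≤a+k)) ⟩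
    suc (x ∸ suc a)                ≡⟨ +-∸-assoc 1 a<x ⟨
    x ∸ a                          ∎
  split (inj₂ refl) =
    trans (rank-of-minimum (a ∷ range (suc a) k) (≤-refl ∷ All.tabulate (<⇒≤ ∘ proj₁ ∘ ∈-range⁻ (suc a) k)))
          (sym (n∸n≡0 a))

==L⇒≡ : ∀ {u v} → T (u ==L v) → u ≡ v
==L⇒≡ {u} {v} = toWitness {a? = ≡-dec _≟_ u v}

≡⇒==L : ∀ {u v} → u ≡ v → T (u ==L v)
≡⇒==L {u} {v} = fromWitness {a? = ≡-dec _≟_ u v}

∈-incSeqs⁻ : ∀ n k {cs} → cs ∈ incSeqs n k → length cs ≡ k × All (Pos n) cs × T (increasing cs)
∈-incSeqs⁻ n k {cs} cs∈ = let (cs∈words , incr) = ∈-filterᵇ⁻ increasing (words n k) cs∈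
                              (len , pos) = ∈-words⁻ n k cs∈words in len , pos , incr

∈-incSeqs⁺ : ∀ n k {cs} → length cs ≡ k → All (Pos n) cs → T (increasing cs) → cs ∈ incSeqs n k
∈-incSeqs⁺ n k len pos incr = ∈-filterᵇ⁺ increasing (∈-words⁺ n k len pos) incr

increasing-head : ∀ cs {a c} → T (increasing cs) → a < at cs 1 → c ∈ cs → a < c
increasing-head (c₀ ∷ [])      _    a<c₀ (here refl) = a<c₀
increasing-head (c₀ ∷ c₁ ∷ cs) _    a<c₀ (here refl) = a<c₀
increasing-head (c₀ ∷ c₁ ∷ cs) incr a<c₀ (there c∈) =
  let (c₀<c₁ , incr′) = T-∧⁻ {c₀ <ᵇ c₁} incr in
  increasing-head (c₁ ∷ cs) incr′ (<-trans a<c₀ (<ᵇ⇒< c₀ c₁ c₀<c₁)) c∈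

record Occurrence (ρ : List ℕ) (u : ℕ) (σ : List ℕ) (ℓ : ℕ) (is : List ℕ) : Set where
  field
    len     : length is ≡ length ρ
    pos     : All (Pos (length σ)) is
    incr    : T (increasing is)
    marked  : at is u ≡ ℓ
    shape   : red (map (at σ) is) ≡ ρ

pmMatch⁻ : ∀ ρ u σ ℓ → T (pmMatch ρ u σ ℓ) → ∃ (Occurrence ρ u σ ℓ)
pmMatch⁻ ρ u σ ℓ t =
  let (is , is∈ , marked∧shape) = any⇒∈ _ (incSeqs (length σ) (length ρ)) t
      (len , pos , incr) = ∈-incSeqs⁻ (length σ) (length ρ) is∈
      (marked , shape) = T-∧⁻ {at is u ≡ᵇ ℓ} marked∧shape
  in is , record { len = len ; pos = pos ; incr = incr ; marked = ≡ᵇ⇒≡ _ _ marked ; shape = ==L⇒≡ shape }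

pmMatch⁺ : ∀ {ρ u σ ℓ is} → Occurrence ρ u σ ℓ is → T (pmMatch ρ u σ ℓ)
pmMatch⁺ {ρ} {u} {σ} {ℓ} {is} o =
  ∈⇒any _ (∈-incSeqs⁺ (length σ) (length ρ) len pos incr) (T-∧⁺ (≡⇒≡ᵇ _ _ marked) (≡⇒==L shape))
  where open Occurrence o

match12⁻ : ∀ lam σ {t} → T (match12 lam σ t)
          → ∃ λ c → c ∈ range 1 (length σ) × c < t × at σ c < at σ t × T (inBoard lam t (at σ t))
match12⁻ lam σ {t} m =
  let (c , c∈ , conds) = any⇒∈ _ (range 1 (length σ)) m
      (c<t , σc<σt , _ , _ , _ , corner) = T-∧⁶⁻ (c <ᵇ t) (at σ c <ᵇ at σ t) (inBoard lam c (at σ c))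
                                             (inBoard lam c (at σ t)) (inBoard lam t (at σ c)) (inBoard lam t (at σ t)) conds
  in c , c∈ , <ᵇ⇒< c t c<t , <ᵇ⇒< _ _ σc<σt , corner

match12⁺ : ∀ lam σ {t c} → c ∈ range 1 (length σ) → c < t → at σ c < at σ t
         → T (inBoard lam c (at σ c)) → T (inBoard lam c (at σ t)) → T (inBoard lam t (at σ c)) → T (inBoard lam t (at σ t))
         → T (match12 lam σ t)
match12⁺ lam σ c∈ c<t σc<σt b₁ b₂ b₃ b₄ = ∈⇒any _ c∈ (T-∧⁶⁺ (<⇒<ᵇ c<t) (<⇒<ᵇ σc<σt) b₁ b₂ b₃ b₄)

match21⁻ : ∀ lam σ {t} → T (match21 lam σ t)
          → ∃ λ c → c ∈ range 1 (length σ) × t < c × at σ c < at σ t × T (inBoard lam c (at σ t))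
match21⁻ lam σ {t} m =
  let (c , c∈ , conds) = any⇒∈ _ (range 1 (length σ)) m
      (t<c , σc<σt , _ , _ , _ , corner) = T-∧⁶⁻ (t <ᵇ c) (at σ c <ᵇ at σ t) (inBoard lam t (at σ c))
                                             (inBoard lam t (at σ t)) (inBoard lam c (at σ c)) (inBoard lam c (at σ t)) conds
  in c , c∈ , <ᵇ⇒< t c t<c , <ᵇ⇒< _ _ σc<σt , corner

match21⁺ : ∀ lam σ {t c} → c ∈ range 1 (length σ) → t < c → at σ c < at σ t
         → T (inBoard lam t (at σ c)) → T (inBoard lam t (at σ t)) → T (inBoard lam c (at σ c)) → T (inBoard lam c (at σ t))
         → T (match21 lam σ t)
match21⁺ lam σ c∈ t<c σc<σt b₁ b₂ b₃ b₄ = ∈⇒any _ c∈ (T-∧⁶⁺ (<⇒<ᵇ t<c) (<⇒<ᵇ σc<σt) b₁ b₂ b₃ b₄)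

module Dominance (τ : List ℕ) where

  record Witness (σ : List ℕ) (a b : ℕ) (cs : List ℕ) : Set where
    field
      len     : length cs ≡ length τ
      pos     : All (Pos (length σ)) cs
      incr    : T (increasing cs)
      right   : a < at cs 1
      above   : All (λ c → b < at σ c) cs
      shape   : red (map (at σ) cs) ≡ τ

  Dominant : List ℕ → ℕ → ℕ → Set
  Dominant σ a b = ∃ (Witness σ a b)

  dominant⁻ : ∀ σ a b → T (dominant τ σ a b) → Dominant σ a b
  dominant⁻ σ a b t =
    let (cs , cs∈ , t′) = any⇒∈ _ (incSeqs (length σ) (length τ)) t
        (len , pos , incr) = ∈-incSeqs⁻ (length σ) (length τ) cs∈
        (right , above∧shape) = T-∧⁻ {a <ᵇ at cs 1} t′
        (above , shape) = T-∧⁻ {all (λ c → b <ᵇ at σ c) cs} above∧shape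
    in cs , record { len = len ; pos = pos ; incr = incr ; right = <ᵇ⇒< a _ right
                   ; above = All.map (<ᵇ⇒< b _) (AllP.all⁺ _ cs above) ; shape = ==L⇒≡ shape }

  dominant⁺ : ∀ σ a b → Dominant σ a b → T (dominant τ σ a b)
  dominant⁺ σ a b (cs , w) =
    ∈⇒any _ (∈-incSeqs⁺ (length σ) (length τ) len pos incr)
      (T-∧⁺ (<⇒<ᵇ right) (T-∧⁺ (AllP.all⁻ _ (All.map <⇒<ᵇ above)) (≡⇒==L shape)))
    where open Witness w

  Witness-mono : ∀ {σ a b a′ b′ cs} → a′ ≤ a → b′ ≤ b → Witness σ a b cs → Witness σ a′ b′ cs
  Witness-mono a′≤a b′≤b w = record
    { len = len ; pos = pos ; incr = incr ; right = ≤-<-trans a′≤a right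
    ; above = All.map (≤-<-trans b′≤b) above ; shape = shape }
    where open Witness w

  Witness-transfer : ∀ {σ σ′ a b cs} → length σ ≡ length σ′ → All (λ c → at σ′ c ≡ at σ c) cs
                   → Witness σ a b cs → Witness σ′ a b cs
  Witness-transfer {σ} {σ′} {b = b} {cs} len≡ same w = record
    { len = len ; pos = subst (λ l → All (Pos l) cs) len≡ pos ; incr = incr ; right = right
    ; above = All.zipWith (λ (e , b<) → subst (b <_) (sym e) b<) (same , above)
    ; shape = trans (cong red (map-cong-local same)) shape }
    where open Witness w

  Witness-right : ∀ {σ a b cs c} → Witness σ a b cs → c ∈ cs → a < c
  Witness-right {cs = cs} w = increasing-head cs (Witness.incr w) (Witness.right w)

module Patterns (m : ℕ) (4≤m : 4 ≤ m) (p : List ℕ) (p↭ : p ↭ range 3 (m ∸ 2)) where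

  τ : List ℕ
  τ = red p

  open Dominance τ public

  length-τ : length τ ≡ m ∸ 2
  length-τ = trans (length-map _ p) (trans (↭-length p↭) (length-range 3 (m ∸ 2)))

  2≤length-τ : 2 ≤ length τ
  2≤length-τ = subst (2 ≤_) (sym length-τ) (∸-monoˡ-≤ 2 4≤m)

  p-bounds : ∀ {x} → x ∈ p → 3 ≤ x × x < 3 + (m ∸ 2)
  p-bounds x∈ = ∈-range⁻ 3 (m ∸ 2) (∈-resp-↭ p↭ x∈)

  shift-τ : map (2 +_) τ ≡ p
  shift-τ = trans (sym (map-∘ p)) (map-id-local (All.tabulate λ {x} x∈ →
    let (3≤x , x<) = p-bounds x∈ in begin
      3 + rank x p                 ≡⟨ cong (3 +_) (countᵇ-↭ (_<ᵇ x) p↭) ⟩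
      3 + rank x (range 3 (m ∸ 2)) ≡⟨ cong (3 +_) (rank-in-range 3 (m ∸ 2) 3≤x (<⇒≤ x<)) ⟩
      3 + (x ∸ 3)                  ≡⟨ m+[n∸m]≡n 3≤x ⟩
      x                            ∎))
    where open ≡-Reasoning

  red-after-two-smaller : ∀ v₁ v₂ w → All (λ x → v₁ < x × v₂ < x) w
                        → map (λ x → suc (rank x (v₁ ∷ v₂ ∷ w))) w ≡ map (2 +_) (red w)
  red-after-two-smaller v₁ v₂ w smaller = trans
    (map-cong-local (All.map (λ (v₁<x , v₂<x) → cong suc
      (trans (rank-∷-< (v₂ ∷ w) v₁<x) (cong suc (rank-∷-< w v₂<x)))) smaller))
    (map-∘ w)

  τ-from-shift : ∀ w → map (2 +_) (red w) ≡ p → red w ≡ τ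
  τ-from-shift w e = map-injective (+-cancelˡ-≡ 2 _ _) (trans e (sym shift-τ))

  private
    rank-reflects-< : ∀ {x y} l → rank x l < rank y l → x < y
    rank-reflects-< l lt = ≰⇒> (λ y≤x → <⇒≱ lt (rank-mono l y≤x))

  -- The entries of w are mapped onto p ⊆ [3, m], so their ranks are at least 2 and v₁, v₂ lie below them.
  red-prefix⁻ : ∀ {v₁ v₂ r₁ r₂} w → r₁ ≤ 2 → r₂ ≤ 2 → red (v₁ ∷ v₂ ∷ w) ≡ r₁ ∷ r₂ ∷ p
              → All (λ u → v₁ < u × v₂ < u) w × red w ≡ τ
  red-prefix⁻ {v₁} {v₂} w r₁≤2 r₂≤2 e =
    smaller , τ-from-shift w (trans (sym (red-after-two-smaller v₁ v₂ w smaller)) e-tail)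
    where
    L = v₁ ∷ v₂ ∷ w
    e₁ = proj₁ (∷-injective e)
    e₂ = proj₁ (∷-injective (proj₂ (∷-injective e)))
    e-tail = proj₂ (∷-injective (proj₂ (∷-injective e)))
    below : ∀ {v r u} → u ∈ w → suc (rank v L) ≡ r → r ≤ 2 → v < u
    below {u = u} u∈ e r≤2 = rank-reflects-< L (<-≤-trans (subst (_≤ 2) (sym e) r≤2)
      (≤-pred (proj₁ (p-bounds (subst (suc (rank u L) ∈_) e-tail (∈-map⁺ _ u∈))))))
    smaller : All (λ u → v₁ < u × v₂ < u) w
    smaller = All.tabulate λ u∈ → below u∈ e₁ r₁≤2 , below u∈ e₂ r₂≤2

  red-P₁⁻ : ∀ v₁ v₂ w → red (v₁ ∷ v₂ ∷ w) ≡ P₁ p → v₁ < v₂ × All (v₂ <_) w × red w ≡ τ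
  red-P₁⁻ v₁ v₂ w e =
    let (smaller , red-w) = red-prefix⁻ w (s≤s z≤n) ≤-refl e
        (e₁ , e₂) = ∷-injective e
    in rank-reflects-< (v₁ ∷ v₂ ∷ w)
         (subst₂ _<_ (sym (suc-injective e₁)) (sym (suc-injective (proj₁ (∷-injective e₂)))) ≤-refl)
     , All.map proj₂ smaller , red-w

  red-P₂⁻ : ∀ v₁ v₂ w → red (v₁ ∷ v₂ ∷ w) ≡ P₂ p → v₂ < v₁ × All (v₁ <_) w × red w ≡ τ
  red-P₂⁻ v₁ v₂ w e =
    let (smaller , red-w) = red-prefix⁻ w ≤-refl (s≤s z≤n) e
        (e₁ , e₂) = ∷-injective e
    in rank-reflects-< (v₁ ∷ v₂ ∷ w)
         (subst₂ _<_ (sym (suc-injective (proj₁ (∷-injective e₂)))) (sym (suc-injective e₁)) ≤-refl)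
     , All.map proj₁ smaller , red-w

  red-P₁⁺ : ∀ v₁ v₂ w → v₁ < v₂ → All (v₂ <_) w → red w ≡ τ → red (v₁ ∷ v₂ ∷ w) ≡ P₁ p
  red-P₁⁺ v₁ v₂ w v₁<v₂ above red-w = cong₂ _∷_
    (cong suc (rank-of-minimum (v₁ ∷ v₂ ∷ w)
      (≤-refl ∷ <⇒≤ v₁<v₂ ∷ All.map (λ v₂<u → <⇒≤ (<-trans v₁<v₂ v₂<u)) above)))
    (cong₂ _∷_
      (cong suc (trans (rank-∷-< (v₂ ∷ w) v₁<v₂)
        (cong suc (rank-of-minimum (v₂ ∷ w) (≤-refl ∷ All.map <⇒≤ above)))))
      (trans (red-after-two-smaller v₁ v₂ w (All.map (λ v₂<u → <-trans v₁<v₂ v₂<u , v₂<u) above))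
             (trans (cong (map (2 +_)) red-w) shift-τ)))

  red-P₂⁺ : ∀ v₁ v₂ w → v₂ < v₁ → All (v₁ <_) w → red w ≡ τ → red (v₁ ∷ v₂ ∷ w) ≡ P₂ p
  red-P₂⁺ v₁ v₂ w v₂<v₁ above red-w = cong₂ _∷_
    (cong suc (trans (rank-∷-≥ {v₁} (v₂ ∷ w) ≤-refl)
      (trans (rank-∷-< w v₂<v₁) (cong suc (rank-of-minimum w (All.map <⇒≤ above))))))
    (cong₂ _∷_
      (cong suc (rank-of-minimum (v₁ ∷ v₂ ∷ w)
        (<⇒≤ v₂<v₁ ∷ ≤-refl ∷ All.map (λ v₁<u → <⇒≤ (<-trans v₂<v₁ v₁<u)) above)))
      (trans (red-after-two-smaller v₁ v₂ w (All.map (λ v₁<u → v₁<u , <-trans v₂<v₁ v₁<u) above))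
             (trans (cong (map (2 +_)) red-w) shift-τ)))

  private
    length-p : length τ ≡ length p
    length-p = length-map _ p

    length-τ≢0 : length τ ≢ 0
    length-τ≢0 e with () ← subst (2 ≤_) e 2≤length-τ

    Witness-nonempty : ∀ {σ a b} → ¬ Witness σ a b []
    Witness-nonempty w = length-τ≢0 (sym (Witness.len w))

  Witness-from-tail : ∀ {σ i b cs} → length cs ≡ length τ → All (Pos (length σ)) cs → T (increasing (i ∷ cs))
                    → All (b <_) (map (at σ) cs) → red (map (at σ) cs) ≡ τ → Witness σ i b cs
  Witness-from-tail {cs = []} len _ _ _ _ = ⊥-elim (length-τ≢0 (sym len))
  Witness-from-tail {i = i} {cs = c₀ ∷ _} len pos incr above shape =
    let (i<c₀ , incr′) = T-∧⁻ {i <ᵇ c₀} incr in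
    record { len = len ; pos = pos ; incr = incr′ ; right = <ᵇ⇒< i c₀ i<c₀ ; above = AllP.map⁻ above ; shape = shape }

  Witness-increasing : ∀ {σ i b cs} → Witness σ i b cs → T (increasing (i ∷ cs))
  Witness-increasing {cs = []}    w = ⊥-elim (Witness-nonempty w)
  Witness-increasing {cs = _ ∷ _} w = T-∧⁺ (<⇒<ᵇ (Witness.right w)) (Witness.incr w)

  P₁Match : List ℕ → ℕ → Set
  P₁Match σ ℓ = ∃ λ c → Pos (length σ) c × Pos (length σ) ℓ × c < ℓ × at σ c < at σ ℓ × Dominant σ ℓ (at σ ℓ)

  P₂Match : List ℕ → ℕ → Set
  P₂Match σ ℓ = ∃ λ c → Pos (length σ) c × Pos (length σ) ℓ × ℓ < c × at σ c < at σ ℓ × Dominant σ c (at σ ℓ)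

  P₁-match⁻ : ∀ σ ℓ → T (pmMatch (P₁ p) 2 σ ℓ) → P₁Match σ ℓ
  P₁-match⁻ σ ℓ t with pmMatch⁻ (P₁ p) 2 σ ℓ t
  ... | i₁ ∷ ℓ ∷ cs , record { len = len ; pos = pos₁ ∷ pos₂ ∷ pos ; incr = incr ; marked = refl ; shape = shape } =
    let (i₁<ℓ , incr′) = T-∧⁻ {i₁ <ᵇ ℓ} incr
        (v₁<v₂ , above , red-cs) = red-P₁⁻ (at σ i₁) (at σ ℓ) (map (at σ) cs) shape
    in i₁ , pos₁ , pos₂ , <ᵇ⇒< i₁ ℓ i₁<ℓ , v₁<v₂
     , cs , Witness-from-tail (trans (suc-injective (suc-injective len)) (sym length-p)) pos incr′ above red-cs

  P₂-match⁻ : ∀ σ ℓ → T (pmMatch (P₂ p) 1 σ ℓ) → P₂Match σ ℓ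
  P₂-match⁻ σ ℓ t with pmMatch⁻ (P₂ p) 1 σ ℓ t
  ... | ℓ ∷ i₂ ∷ cs , record { len = len ; pos = pos₁ ∷ pos₂ ∷ pos ; incr = incr ; marked = refl ; shape = shape } =
    let (ℓ<i₂ , incr′) = T-∧⁻ {ℓ <ᵇ i₂} incr
        (v₂<v₁ , above , red-cs) = red-P₂⁻ (at σ ℓ) (at σ i₂) (map (at σ) cs) shape
    in i₂ , pos₂ , pos₁ , <ᵇ⇒< ℓ i₂ ℓ<i₂ , v₂<v₁
     , cs , Witness-from-tail (trans (suc-injective (suc-injective len)) (sym length-p)) pos incr′ above red-cs

  P₁-match⁺ : ∀ σ ℓ → P₁Match σ ℓ → T (pmMatch (P₁ p) 2 σ ℓ)
  P₁-match⁺ σ ℓ (c , c∈ , ℓ∈ , c<ℓ , σc<σℓ , cs , w) = pmMatch⁺ {P₁ p} {2} {σ} {ℓ} {c ∷ ℓ ∷ cs} record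
    { len = cong (2 +_) (trans len length-p) ; pos = c∈ ∷ ℓ∈ ∷ pos
    ; incr = T-∧⁺ (<⇒<ᵇ c<ℓ) (Witness-increasing w) ; marked = refl
    ; shape = red-P₁⁺ _ _ _ σc<σℓ (AllP.map⁺ above) shape }
    where open Witness w

  P₂-match⁺ : ∀ σ ℓ → P₂Match σ ℓ → T (pmMatch (P₂ p) 1 σ ℓ)
  P₂-match⁺ σ ℓ (c , c∈ , ℓ∈ , ℓ<c , σc<σℓ , cs , w) = pmMatch⁺ {P₂ p} {1} {σ} {ℓ} {ℓ ∷ c ∷ cs} record
    { len = cong (2 +_) (trans len length-p) ; pos = ℓ∈ ∷ c∈ ∷ pos
    ; incr = T-∧⁺ (<⇒<ᵇ ℓ<c) (Witness-increasing w) ; marked = refl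
    ; shape = red-P₂⁺ _ _ _ σc<σℓ (AllP.map⁺ above) shape }
    where open Witness w

module Board (τ : List ℕ) (Q : Cells) (n : ℕ) (Q⊆grid : Q ⊆grid n) where

  open Dominance τ

  Q-column : ∀ {a b} → T (Q a b) → Pos n a
  Q-column {a} {b} t = inRange⁻ n (proj₁ (T-∧⁻ {inRange 1 n a} (Q⊆grid a b t)))

  Q-row : ∀ {a b} → T (Q a b) → Pos n b
  Q-row {a} {b} t = inRange⁻ n (proj₂ (T-∧⁻ {inRange 1 n a} (Q⊆grid a b t)))

  record Member (π : List ℕ) : Set where
    field
      len    : length π ≡ n
      unique : Unique π
      values : All (Pos n) π
      covers : ∀ {v} → Pos n v → v ∈ π
      ND≡Q   : ∀ {a b} → Pos n a → Pos n b → Q a b ≡ inND τ π a b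

  member : ∀ π → T (inSnQ τ Q n π) → Member π
  member π t = record
    { len = len ; unique = proj₁ (isPerm⇒unique n π perm) ; values = proj₂ (isPerm⇒unique n π perm)
    ; covers = covers
    ; ND≡Q = λ {a} {b} a∈ b∈ → toWitness {a? = Q a b Bool.≟ inND τ π a b}
        (all⇒∈ _ (range 1 n) (all⇒∈ _ (range 1 n) ND (∈-range1⁺ n a∈)) (∈-range1⁺ n b∈)) }
    where
    perm = proj₁ (T-∧⁻ {isPerm n π} t)
    ND = proj₂ (T-∧⁻ {isPerm n π} t)
    len = proj₁ (isPerm⁻ n π perm)
    covers = proj₂ (isPerm⁻ n π perm)

  module _ {π : List ℕ} (mem : Member π) where
    open Member mem

    pos-π : ∀ {c} → Pos n c → Pos (length π) c
    pos-π {c} (1≤c , c≤n) = 1≤c , subst (c ≤_) (sym len) c≤n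

    value : ∀ {c} → Pos n c → Pos n (at π c)
    value c∈ = All.lookup values (at-∈ π (pos-π c∈))

    cross-injective : ∀ {i j} → Pos n i → Pos n j → at π i ≡ at π j → i ≡ j
    cross-injective i∈ j∈ = at-injective π unique (pos-π i∈) (pos-π j∈)

    private
      ND⁻ : ∀ {a b} → T (Q a b) → T (at π a ≡ᵇ b) × ¬ T (dominant τ π a b)
      ND⁻ {a} {b} t =
        let (_ , rest) = T-∧⁻ {inRange 1 (length π) a} (subst T (ND≡Q (Q-column t) (Q-row t)) t)
            (cross , nondom) = T-∧⁻ {at π a ≡ᵇ b} rest
        in cross , T-not⁻ nondom

    Q-cross : ∀ {a b} → T (Q a b) → at π a ≡ b
    Q-cross t = ≡ᵇ⇒≡ _ _ (proj₁ (ND⁻ t))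

    Q-nondominant : ∀ {a b} → T (Q a b) → ¬ T (dominant τ π a b)
    Q-nondominant t = proj₂ (ND⁻ t)

    dominant-unless-Q : ∀ {a} → Pos n a → ¬ T (Q a (at π a)) → T (dominant τ π a (at π a))
    dominant-unless-Q {a} a∈ ¬Q with T? (dominant τ π a (at π a))
    ... | yes dom = dom
    ... | no ¬dom = ⊥-elim (¬Q (subst T (sym (ND≡Q a∈ (value a∈)))
                      (T-∧⁺ (inRange⁺ (length π) (pos-π a∈)) (T-∧⁺ (≡⇒≡ᵇ (at π a) _ refl) (T-not⁺ ¬dom)))))

    Q-in-row-of : ∀ {a c} → Pos n c → T (Q a (at π c)) → a ≡ c
    Q-in-row-of c∈ t = cross-injective (Q-column t) c∈ (Q-cross t)

  OnQ : List ℕ → List ℕ → Set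
  OnQ π cs = All (λ c → T (Q c (at π c))) cs

  -- A witness column whose cross is outside Q carries a dominant cross, whose own witness lies further up
  -- and to the right and so also witnesses (a, b); the fuel bounds n ∸ a, which strictly decreases.
  Q-witness : ∀ {π} → Member π → ∀ fuel {a b cs} → n ∸ a ≤ fuel → Witness π a b cs
            → ∃ λ cs′ → Witness π a b cs′ × OnQ π cs′
  Q-witness {π} mem fuel {a} {b} {cs} n∸a≤fuel w with All.all? (λ c → T? (Q c (at π c))) cs
  ... | yes onQ = cs , w , onQ
  ... | no ¬onQ with c , c∈ , ¬Q ← find (AllP.¬All⇒Any¬ (λ c → T? (Q c (at π c))) cs ¬onQ) =
    descend fuel n∸a≤fuel
    where
    c∈n : Pos n c
    c∈n = let (1≤c , c≤) = All.lookup (Witness.pos w) c∈ in 1≤c , subst (c ≤_) (Member.len mem) c≤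
    a<c = Witness-right w c∈
    b<πc = All.lookup (Witness.above w) c∈
    n∸c<n∸a = ∸-monoʳ-< a<c (proj₂ c∈n)
    descend : ∀ fuel → n ∸ a ≤ fuel → ∃ λ cs′ → Witness π a b cs′ × OnQ π cs′
    descend zero    n∸a≤0 = ⊥-elim (<⇒≱ n∸c<n∸a (≤-trans n∸a≤0 z≤n))
    descend (suc f) n∸a≤1+f =
      let (cs₁ , w₁) = dominant⁻ π c (at π c) (dominant-unless-Q mem c∈n ¬Q)
          (cs₂ , w₂ , onQ) = Q-witness mem f (≤-pred (<-≤-trans n∸c<n∸a n∸a≤1+f)) w₁
      in cs₂ , Witness-mono (<⇒≤ a<c) (<⇒≤ b<πc) w₂ , onQ

  dominant-transfer : ∀ {π π′} → Member π → length π′ ≡ n → (∀ {a b} → T (Q a b) → at π′ a ≡ b)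
                    → ∀ {a b} → T (dominant τ π a b) → T (dominant τ π′ a b)
  dominant-transfer {π} {π′} mem len′ Q-cross′ {a} {b} dom =
    let (cs₀ , w₀) = dominant⁻ π a b dom
        (cs , w , onQ) = Q-witness mem (n ∸ a) ≤-refl w₀
    in dominant⁺ π′ a b (cs , Witness-transfer (trans (Member.len mem) (sym len′))
         (All.map (λ Q-c → trans (Q-cross′ Q-c) (sym (Q-cross mem Q-c))) onQ) w)

  cols rows : List ℕ
  cols = remCols Q n
  rows = remRows Q n

  k : ℕ
  k = length cols

  ∈-cols⁻ : ∀ {c} → c ∈ cols → Pos n c × (∀ b → ¬ T (Q c b))
  ∈-cols⁻ {c} c∈ = let (c∈n , free) = ∈-filterᵇ⁻ _ (range 1 n) c∈ in
    ∈-range1⁻ n c∈n , λ b t → T-not⁻ free (∈⇒any (Q c) (∈-range1⁺ n (Q-row t)) t)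

  ∈-cols⁺ : ∀ {c} → Pos n c → (∀ b → ¬ T (Q c b)) → c ∈ cols
  ∈-cols⁺ {c} c∈n free = ∈-filterᵇ⁺ _ (∈-range1⁺ n c∈n)
    (T-not⁺ (λ t → let (b , _ , Qcb) = any⇒∈ (Q c) (range 1 n) t in free b Qcb))

  ∈-rows⁻ : ∀ {r} → r ∈ rows → Pos n r × (∀ a → ¬ T (Q a r))
  ∈-rows⁻ {r} r∈ = let (r∈n , free) = ∈-filterᵇ⁻ _ (range 1 n) r∈ in
    ∈-range1⁻ n r∈n , λ a t → T-not⁻ free (∈⇒any (λ a → Q a r) (∈-range1⁺ n (Q-column t)) t)

  ∈-rows⁺ : ∀ {r} → Pos n r → (∀ a → ¬ T (Q a r)) → r ∈ rows
  ∈-rows⁺ {r} r∈n free = ∈-filterᵇ⁺ _ (∈-range1⁺ n r∈n)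
    (T-not⁺ (λ t → let (a , _ , Qar) = any⇒∈ (λ a → Q a r) (range 1 n) t in free a Qar))

  cols-sorted : AllPairs _<_ cols
  cols-sorted = AllPairsP.filter⁺ _ (range-sorted 1 n)

  rows-sorted : AllPairs _<_ rows
  rows-sorted = AllPairsP.filter⁺ _ (range-sorted 1 n)

  cols-unique : Unique cols
  cols-unique = sorted⇒unique cols-sorted

  rows-unique : Unique rows
  rows-unique = sorted⇒unique rows-sorted

  count-on-free-columns : ∀ (M N : ℕ → Bool) → (∀ {ℓ} → T (M ℓ) → ℓ ∈ cols)
                        → (∀ {i} → Pos k i → M (at cols i) ≡ N i) → countᵇ N (range 1 k) ≡ countᵇ M (range 1 n)
  count-on-free-columns M N M⇒free M≡N = begin
    countᵇ N (range 1 k)              ≡⟨ countᵇ-cong N (M ∘ at cols) (range 1 k) (sym ∘ M≡N ∘ ∈-range1⁻ k) ⟩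
    countᵇ (M ∘ at cols) (range 1 k)  ≡⟨ countᵇ-by-position M cols ⟨
    countᵇ M cols                     ≡⟨ countᵇ-filterᵇ M _ (range 1 n) (λ _ → proj₂ ∘ ∈-filterᵇ⁻ _ (range 1 n) ∘ M⇒free) ⟨
    countᵇ M (range 1 n)              ∎
    where open ≡-Reasoning

  module _ {π : List ℕ} (mem : Member π) where

    free-column : ∀ {c} → Pos n c → ¬ T (Q c (at π c)) → c ∈ cols
    free-column {c} c∈n ¬Q = ∈-cols⁺ c∈n (λ b Qcb → ¬Q (subst (T ∘ Q c) (sym (Q-cross mem Qcb)) Qcb))

    row-of-free-column : ∀ {c} → c ∈ cols → at π c ∈ rows
    row-of-free-column {c} c∈ = let (c∈n , free) = ∈-cols⁻ c∈ in
      ∈-rows⁺ (value mem c∈n) (λ a Qa → free (at π c) (subst (λ a → T (Q a (at π c))) (Q-in-row-of mem c∈n Qa) Qa))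

    column-of-free-row : ∀ {c} → Pos n c → at π c ∈ rows → c ∈ cols
    column-of-free-row c∈n r∈ = free-column c∈n (proj₂ (∈-rows⁻ r∈) _)

    length-rows≡k : length rows ≡ k
    length-rows≡k = ≤-antisym
      (length≤-by-injection (λ r → position r π) rows cols (rows-unique)
         (λ r∈ → let (i∈ , πi≡r) = position-∈ π (Member.covers mem (proj₁ (∈-rows⁻ r∈))) in
            column-of-free-row (proj₁ i∈ , subst (_ ≤_) (Member.len mem) (proj₂ i∈)) (subst (_∈ rows) (sym πi≡r) r∈))
         (λ {r} {r′} r∈ r′∈ e →
            let (_ , πi≡r) = position-∈ π (Member.covers mem (proj₁ (∈-rows⁻ r∈)))
                (_ , πi′≡r′) = position-∈ π (Member.covers mem (proj₁ (∈-rows⁻ r′∈)))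
            in trans (sym πi≡r) (trans (cong (at π) e) πi′≡r′)))
      (length≤-by-injection (at π) cols rows (cols-unique) row-of-free-column
         (λ c∈ c′∈ → cross-injective mem (proj₁ (∈-cols⁻ c∈)) (proj₁ (∈-cols⁻ c′∈))))

  module Compression (π₀ : List ℕ) (π₀∈ : T (inSnQ τ Q n π₀)) where

    mem₀ : Member π₀
    mem₀ = member π₀ π₀∈

    D : ℕ → ℕ → Set
    D a b = T (dominant τ π₀ a b)

    dominant⇒D : ∀ {π} → Member π → ∀ {a b} → T (dominant τ π a b) → D a b
    dominant⇒D mem = dominant-transfer {π′ = π₀} mem (Member.len mem₀) (Q-cross mem₀)

    D⇒dominant : ∀ {π} → Member π → ∀ {a b} → D a b → T (dominant τ π a b)
    D⇒dominant {π} mem = dominant-transfer {π′ = π} mem₀ (Member.len mem) (Q-cross mem)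

    D-mono : ∀ {a b a′ b′} → a′ ≤ a → b′ ≤ b → D a b → D a′ b′
    D-mono {a} {b} {a′} {b′} a′≤a b′≤b d =
      let (cs , w) = dominant⁻ π₀ a b d in dominant⁺ π₀ a′ b′ (cs , Witness-mono a′≤a b′≤b w)

    D-free-cross : ∀ {π} → Member π → ∀ {c} → c ∈ cols → D c (at π c)
    D-free-cross mem c∈ = let (c∈n , free) = ∈-cols⁻ c∈ in
      dominant⇒D mem (dominant-unless-Q mem c∈n (free _))

    length-rows : length rows ≡ k
    length-rows = length-rows≡k mem₀

    Pos-rows : ∀ {j} → Pos k j → Pos (length rows) j
    Pos-rows {j} (1≤j , j≤k) = 1≤j , subst (j ≤_) (sym length-rows) j≤k

    lam : List ℕ
    lam = lambdaQ τ Q n π₀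

    length-lam : length lam ≡ k
    length-lam = trans (length-map _ rows) length-rows

    row-length : ℕ → ℕ
    row-length b = countᵇ (λ a → dominant τ π₀ a b) cols

    at-lam : ∀ {j} → Pos k j → at lam j ≡ row-length (at rows j)
    at-lam j∈ = at-map row-length rows (Pos-rows j∈)

    D-downclosed : ∀ b → DownClosedAlong (λ a → dominant τ π₀ a b) cols
    D-downclosed b 1≤i i≤j j≤k = D-mono (at-mono-≤ cols cols-sorted 1≤i i≤j j≤k) ≤-refl

    board⁻ : ∀ {x y} → T (inBoard lam x y) → Pos k y × Pos k x × D (at cols x) (at rows y)
    board⁻ {x} {y} t =
      let (y∈ , x∈) = T-∧⁻ {inRange 1 (length lam) y} t
          (1≤y , y≤) = inRange⁻ (length lam) y∈
          y∈k = 1≤y , subst (y ≤_) length-lam y≤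
          (1≤x , x≤) = inRange⁻ (at lam y) x∈
          x≤row = subst (x ≤_) (at-lam y∈k) x≤
      in y∈k , (1≤x , ≤-trans x≤row (countᵇ≤length _ cols))
       , at-prefix⁻ _ cols (D-downclosed _) 1≤x x≤row

    board⁺ : ∀ {x y} → Pos k y → Pos k x → D (at cols x) (at rows y) → T (inBoard lam x y)
    board⁺ {x} {y} (1≤y , y≤k) x∈@(1≤x , _) d = T-∧⁺
      (inRange⁺ _ (1≤y , subst (y ≤_) (sym length-lam) y≤k))
      (inRange⁺ _ (1≤x , subst (x ≤_) (sym (at-lam (1≤y , y≤k))) (at-prefix⁺ _ cols (D-downclosed _) x∈ d)))

    -- Every free cross is dominant and lies in a free row, so the bottom row of λ is full.
    ncols-lam : ncols lam ≡ k
    ncols-lam with rows in rows≡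
    ... | []     = sym (trans (sym length-rows) (cong length rows≡))
    ... | r ∷ rs = countᵇ-all _ cols λ {c} c∈ →
      let (j , j∈ , rows[j]≡) = ∈⇒at rows (row-of-free-column mem₀ c∈)
          r≤πc = subst₂ _≤_ (cong (λ l → at l 1) rows≡) rows[j]≡
                   (at-mono-≤ rows rows-sorted (s≤s z≤n) (proj₁ j∈) (proj₂ j∈))
      in D-mono ≤-refl r≤πc (D-free-cross mem₀ c∈)

    record Filling (σ : List ℕ) : Set where
      field
        len    : length σ ≡ k
        values : All (Pos k) σ
        covers : ∀ {j} → Pos k j → j ∈ σ
        inside : ∀ {i} → Pos k i → T (inBoard lam i (at σ i))

    ∈-fillings⁻ : ∀ {σ} → σ ∈ fillings lam → Filling σ
    ∈-fillings⁻ {σ} σ∈ =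
      let (σ∈words , t) = ∈-filterᵇ⁻ _ (words (length lam) (ncols lam)) σ∈
          (len , values) = ∈-words⁻ _ _ σ∈words
          (perm , inside) = T-∧⁻ {isPerm (length lam) σ} t
      in record
        { len = trans len ncols-lam
        ; values = subst (λ l → All (Pos l) σ) length-lam values
        ; covers = λ {j} j∈ → proj₂ (isPerm⁻ _ σ perm) (subst (λ l → Pos l j) (sym length-lam) j∈)
        ; inside = λ {i} i∈ → all⇒∈ _ (range 1 (ncols lam)) inside
                                (∈-range1⁺ _ (subst (λ l → Pos l i) (sym ncols-lam) i∈)) }

    ∈-fillings⁺ : ∀ {σ} → Filling σ → σ ∈ fillings lam
    ∈-fillings⁺ {σ} f = ∈-filterᵇ⁺ _
      (∈-words⁺ _ _ (trans len (sym ncols-lam)) (subst (λ l → All (Pos l) σ) (sym length-lam) values))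
      (T-∧⁺ (isPerm⁺ _ σ (trans len (sym length-lam)) (λ {v} v∈ → covers (subst (λ l → Pos l v) length-lam v∈)))
            (∈⇒all _ (range 1 (ncols lam)) (λ {i} i∈ → inside (subst (λ l → Pos l i) ncols-lam (∈-range1⁻ _ i∈)))))
      where open Filling f

    compress : List ℕ → List ℕ
    compress π = map (λ i → position (at π (at cols i)) rows) (range 1 k)

    Q-row-of : ℕ → ℕ
    Q-row-of a = at (filterᵇ (Q a) (range 1 n)) 1

    expand-at : List ℕ → ℕ → ℕ
    expand-at σ a = if colHasQ Q n a then Q-row-of a else at rows (at σ (position a cols))

    expand : List ℕ → List ℕ
    expand σ = map (expand-at σ) (range 1 n)

    Q-row-of-spec : ∀ {a b} → T (Q a b) → Q-row-of a ≡ b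
    Q-row-of-spec {a} {b} Qab with filterᵇ (Q a) (range 1 n) in e | ∈-filterᵇ⁺ (Q a) (∈-range1⁺ n (Q-row Qab)) Qab
    ... | b′ ∷ _ | _ = trans (sym (Q-cross mem₀ Qab′)) (Q-cross mem₀ Qab)
      where Qab′ = proj₂ (∈-filterᵇ⁻ (Q a) (range 1 n) (subst (b′ ∈_) (sym e) (here refl)))

    expand-at-Q : ∀ σ {a b} → T (Q a b) → expand-at σ a ≡ b
    expand-at-Q σ {a} Qab with colHasQ Q n a in e
    ... | true  = Q-row-of-spec Qab
    ... | false = ⊥-elim (subst T e (∈⇒any (Q a) (∈-range1⁺ n (Q-row Qab)) Qab))

    expand-at-free : ∀ σ {a} → a ∈ cols → expand-at σ a ≡ at rows (at σ (position a cols))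
    expand-at-free σ {a} a∈ with colHasQ Q n a in e
    ... | true  = let (b , _ , Qab) = any⇒∈ (Q a) (range 1 n) (subst T (sym e) _) in ⊥-elim (proj₂ (∈-cols⁻ a∈) b Qab)
    ... | false = refl

    length-compress : ∀ π → length (compress π) ≡ k
    length-compress π = length-map-range _ k

    at-compress : ∀ π {i} → Pos k i → at (compress π) i ≡ position (at π (at cols i)) rows
    at-compress π = at-map-range _ k

    length-expand : ∀ σ → length (expand σ) ≡ n
    length-expand σ = length-map-range _ n

    at-expand : ∀ σ {a} → Pos n a → at (expand σ) a ≡ expand-at σ a
    at-expand σ = at-map-range _ n

    at-cols-∈ : ∀ {i} → Pos k i → at cols i ∈ cols
    at-cols-∈ = at-∈ cols

    position-cols : ∀ {c} → c ∈ cols → Pos k (position c cols) × at cols (position c cols) ≡ c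
    position-cols = position-∈ cols

    position-rows : ∀ {r} → r ∈ rows → Pos k (position r rows) × at rows (position r rows) ≡ r
    position-rows {r} r∈ = let ((1≤j , j≤) , e) = position-∈ rows r∈ in
      (1≤j , subst (position r rows ≤_) length-rows j≤) , e

    module _ {π : List ℕ} (mem : Member π) where

      compress-row : ∀ {i} → Pos k i → Pos k (at (compress π) i) × at rows (at (compress π) i) ≡ at π (at cols i)
      compress-row i∈ rewrite at-compress π i∈ = position-rows (row-of-free-column mem (at-cols-∈ i∈))

      Pos-compress : ∀ {i} → Pos k i → Pos (length (compress π)) i
      Pos-compress {i} (1≤i , i≤k) = 1≤i , subst (i ≤_) (sym (length-compress π)) i≤k

      compress-filling : Filling (compress π)
      compress-filling = record
        { len = length-compress π
        ; values = All.tabulate λ j∈ →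
            let (i , (1≤i , i≤) , e) = ∈⇒at (compress π) j∈ in
            subst (Pos k) e (proj₁ (compress-row (1≤i , subst (i ≤_) (length-compress π) i≤)))
        ; covers = λ {j} j∈k →
            let r∈ = at-∈ rows (Pos-rows j∈k)
                (c , c∈n , πc≡r) = ∈⇒at π (Member.covers mem (proj₁ (∈-rows⁻ r∈)))
                c∈n′ = proj₁ c∈n , subst (c ≤_) (Member.len mem) (proj₂ c∈n)
                c∈ = column-of-free-row mem c∈n′ (subst (_∈ rows) (sym πc≡r) r∈)
                (i∈ , cols[i]≡c) = position-cols c∈
                compress[i]≡j = begin
                  at (compress π) (position c cols)                ≡⟨ at-compress π i∈ ⟩
                  position (at π (at cols (position c cols))) rows ≡⟨ cong (λ c → position (at π c) rows) cols[i]≡c ⟩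
                  position (at π c) rows                           ≡⟨ cong (λ r → position r rows) πc≡r ⟩
                  position (at rows j) rows                        ≡⟨ position-at rows (rows-unique) (Pos-rows j∈k) ⟩
                  j                                                ∎
            in subst (_∈ compress π) compress[i]≡j (at-∈ (compress π) (Pos-compress i∈))
        ; inside = λ i∈ → let (j∈ , rows[j]≡) = compress-row i∈ in
            board⁺ j∈ i∈ (subst (D (at cols _)) (sym rows[j]≡) (D-free-cross mem (at-cols-∈ i∈)))
        }
        where open ≡-Reasoning

      expand-compress : expand (compress π) ≡ π
      expand-compress = at-ext (expand (compress π)) π (trans (length-expand (compress π)) (sym (Member.len mem)))
        λ {a} (1≤a , a≤) →
          let a∈n = 1≤a , subst (a ≤_) (length-expand (compress π)) a≤ in
          trans (at-expand (compress π) a∈n) (expand-at-compress a∈n)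
        where
        expand-at-compress : ∀ {a} → Pos n a → expand-at (compress π) a ≡ at π a
        expand-at-compress {a} a∈n with T? (Q a (at π a))
        ... | yes Qa = expand-at-Q (compress π) Qa
        ... | no ¬Q = let a∈ = free-column mem a∈n ¬Q ; (i∈ , cols[i]≡a) = position-cols a∈ in begin
          expand-at (compress π) a                        ≡⟨ expand-at-free (compress π) a∈ ⟩
          at rows (at (compress π) (position a cols))     ≡⟨ proj₂ (compress-row i∈) ⟩
          at π (at cols (position a cols))                ≡⟨ cong (at π) cols[i]≡a ⟩
          at π a                                          ∎
          where open ≡-Reasoning

    module _ {σ : List ℕ} (fill : Filling σ) where
      open Filling fill

      private
        π : List ℕ
        π = expand σ

        Pos-π : ∀ {a} → Pos n a → Pos (length π) a
        Pos-π {a} (1≤a , a≤n) = 1≤a , subst (a ≤_) (sym (length-expand σ)) a≤n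

        Pos-σ : ∀ {i} → Pos k i → Pos (length σ) i
        Pos-σ {i} (1≤i , i≤k) = 1≤i , subst (i ≤_) (sym len) i≤k

      expand-Q-cross : ∀ {a b} → T (Q a b) → at π a ≡ b
      expand-Q-cross Qab = trans (at-expand σ (Q-column Qab)) (expand-at-Q σ Qab)

      expand-free : ∀ {a} → a ∈ cols → at π a ≡ at rows (at σ (position a cols))
      expand-free a∈ = trans (at-expand σ (proj₁ (∈-cols⁻ a∈))) (expand-at-free σ a∈)

      expand-D : ∀ {a} → a ∈ cols → D a (at π a)
      expand-D a∈ =
        let (i∈ , cols[i]≡a) = position-cols a∈ ; (_ , _ , d) = board⁻ (inside i∈) in
        subst₂ D cols[i]≡a (sym (expand-free a∈)) d

      expand-free-column : ∀ {c} → Pos n c → ¬ T (Q c (at π c)) → c ∈ cols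
      expand-free-column {c} c∈n ¬Q = ∈-cols⁺ c∈n (λ b Qcb → ¬Q (subst (T ∘ Q c) (sym (expand-Q-cross Qcb)) Qcb))

      expand-value : ∀ {a} → Pos n a → Pos n (at π a)
      expand-value {a} a∈n with T? (colHasQ Q n a)
      ... | yes t = let (b , _ , Qab) = any⇒∈ (Q a) (range 1 n) t in subst (Pos n) (sym (expand-Q-cross Qab)) (Q-row Qab)
      ... | no ¬t =
        let a∈ = ∈-cols⁺ a∈n (λ b Qab → ¬t (∈⇒any (Q a) (∈-range1⁺ n (Q-row Qab)) Qab))
            (i∈ , _) = position-cols a∈
            σi∈ = All.lookup values (at-∈ σ (Pos-σ i∈))
        in subst (Pos n) (sym (expand-free a∈)) (proj₁ (∈-rows⁻ (at-∈ rows (Pos-rows σi∈))))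

      -- A witness either lies on Q, where expand σ agrees with π₀, or meets a free column, whose cross is
      -- in λ and hence dominant for π₀.
      dominant-expand⁻ : ∀ {a b} → T (dominant τ π a b) → D a b
      dominant-expand⁻ {a} {b} dom with cs , w ← dominant⁻ π a b dom
                                   with All.all? (λ c → T? (Q c (at π c))) cs
      ... | yes onQ = dominant⁺ π₀ a b (cs , Witness-transfer (trans (length-expand σ) (sym (Member.len mem₀)))
                        (All.map (λ Q-c → trans (Q-cross mem₀ Q-c) (sym (expand-Q-cross Q-c))) onQ) w)
      ... | no ¬onQ with c , c∈ , ¬Q ← find (AllP.¬All⇒Any¬ (λ c → T? (Q c (at π c))) cs ¬onQ) =
        let (1≤c , c≤) = All.lookup (Witness.pos w) c∈ in
        D-mono (<⇒≤ (Witness-right w c∈)) (<⇒≤ (All.lookup (Witness.above w) c∈))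
          (expand-D (expand-free-column (1≤c , subst (c ≤_) (length-expand σ) c≤) ¬Q))

      dominant-expand⁺ : ∀ {a b} → D a b → T (dominant τ π a b)
      dominant-expand⁺ = dominant-transfer {π′ = π} mem₀ (length-expand σ) expand-Q-cross

      expand-ND≡Q : ∀ {a b} → Pos n a → Pos n b → Q a b ≡ inND τ π a b
      expand-ND≡Q {a} {b} a∈n b∈n = T-injective to from
        where
        to : T (Q a b) → T (inND τ π a b)
        to Qab = T-∧⁺ (inRange⁺ _ (Pos-π a∈n))
          (T-∧⁺ (≡⇒≡ᵇ _ _ (expand-Q-cross Qab)) (T-not⁺ (Q-nondominant mem₀ Qab ∘ dominant-expand⁻)))
        from : T (inND τ π a b) → T (Q a b)
        from t with T? (Q a b)
        ... | yes Qab = Qab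
        ... | no ¬Qab =
          let (cross , nondom) = T-∧⁻ {at π a ≡ᵇ b} (proj₂ (T-∧⁻ {inRange 1 (length π) a} t))
              πa≡b = ≡ᵇ⇒≡ _ _ cross
              a∈ = expand-free-column a∈n (λ Q-a → ¬Qab (subst (T ∘ Q a) πa≡b Q-a))
          in ⊥-elim (T-not⁻ nondom (dominant-expand⁺ (subst (D a) πa≡b (expand-D a∈))))

      expand-covers : ∀ {v} → Pos n v → v ∈ π
      expand-covers {v} v∈n with T? (rowHasQ Q n v)
      ... | yes t = let (a , _ , Qav) = any⇒∈ (λ a → Q a v) (range 1 n) t in
        subst (_∈ π) (expand-Q-cross Qav) (at-∈ π (Pos-π (Q-column Qav)))
      ... | no ¬t =
        let r∈ = ∈-rows⁺ v∈n (λ a Qav → ¬t (∈⇒any (λ a → Q a v) (∈-range1⁺ n (Q-column Qav)) Qav))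
            (j∈ , rows[j]≡v) = position-rows r∈
            (i , (1≤i , i≤) , σi≡j) = ∈⇒at σ (covers j∈)
            i∈ = 1≤i , subst (i ≤_) len i≤
            c∈ = at-cols-∈ i∈
            expand-c≡v = begin
              at π (at cols i)                             ≡⟨ expand-free c∈ ⟩
              at rows (at σ (position (at cols i) cols))   ≡⟨ cong (at rows ∘ at σ) (position-at cols (cols-unique) i∈) ⟩
              at rows (at σ i)                             ≡⟨ cong (at rows) σi≡j ⟩
              at rows (position v rows)                    ≡⟨ rows[j]≡v ⟩
              v                                            ∎
        in subst (_∈ π) expand-c≡v (at-∈ π (Pos-π (proj₁ (∈-cols⁻ c∈))))
        where open ≡-Reasoning

      expand-∈-SnQ : π ∈ SnQ τ Q n
      expand-∈-SnQ = ∈-filterᵇ⁺ _ (∈-filterᵇ⁺ _ π∈words perm)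
        (T-∧⁺ perm (∈⇒all _ (range 1 n) λ a∈ → ∈⇒all _ (range 1 n) λ b∈ →
           fromWitness (expand-ND≡Q (∈-range1⁻ n a∈) (∈-range1⁻ n b∈))))
        where
        perm = isPerm⁺ n π (length-expand σ) expand-covers
        π∈words = ∈-words⁺ n n (length-expand σ) (All.tabulate λ v∈ →
          let (a , (1≤a , a≤) , πa≡v) = ∈⇒at π v∈ in
          subst (Pos n) πa≡v (expand-value (1≤a , subst (a ≤_) (length-expand σ) a≤)))

      compress-expand : compress π ≡ σ
      compress-expand = at-ext (compress π) σ (trans (length-compress π) (sym len)) λ {i} (1≤i , i≤) →
        let i∈ = 1≤i , subst (i ≤_) (length-compress π) i≤ in begin
          at (compress π) i                                             ≡⟨ at-compress π i∈ ⟩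
          position (at π (at cols i)) rows                              ≡⟨ cong (λ r → position r rows) (expand-free (at-cols-∈ i∈)) ⟩
          position (at rows (at σ (position (at cols i) cols))) rows    ≡⟨ cong (λ j → position (at rows (at σ j)) rows)
                                                                             (position-at cols (cols-unique) i∈) ⟩
          position (at rows (at σ i)) rows                              ≡⟨ position-at rows (rows-unique)
                                                                             (Pos-rows (All.lookup values (at-∈ σ (Pos-σ i∈)))) ⟩
          at σ i                                                        ∎
        where open ≡-Reasoning

    ∈-SnQ⇒Member : ∀ {π} → π ∈ SnQ τ Q n → Member π
    ∈-SnQ⇒Member {π} π∈ = member π (proj₂ (∈-filterᵇ⁻ _ (Sn n) π∈))

    genPoly-compress : (s t : List ℕ → ℕ) → (∀ {π} → Member π → t (compress π) ≡ s π)
                     → ∀ K → genPoly (SnQ τ Q n) s K ≡ genPoly (fillings lam) t K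
    genPoly-compress s t t∘compress≡s = genPoly-bijection (SnQ τ Q n) (fillings lam) compress expand
      (UniqueP.filter⁺ _ (UniqueP.filter⁺ _ (words-unique n n)))
      (UniqueP.filter⁺ _ (words-unique (length lam) (ncols lam)))
      (∈-fillings⁺ ∘ compress-filling ∘ ∈-SnQ⇒Member)
      (expand-∈-SnQ ∘ ∈-fillings⁻)
      (expand-compress ∘ ∈-SnQ⇒Member)
      (compress-expand ∘ ∈-fillings⁻)
      s t (t∘compress≡s ∘ ∈-SnQ⇒Member)

module Statistics (m : ℕ) (4≤m : 4 ≤ m) (p : List ℕ) (p↭ : p ↭ range 3 (m ∸ 2))
                  (Q : Cells) (n : ℕ) (Q⊆grid : Q ⊆grid n) (π₀ : List ℕ) (π₀∈ : T (inSnQ (red p) Q n π₀)) where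

  open Patterns m 4≤m p p↭
  open Board τ Q n Q⊆grid
  open Compression π₀ π₀∈

  module _ {π : List ℕ} (mem : Member π) where

    private
      σ : List ℕ
      σ = compress π

      Pos-n : ∀ {c} → Pos (length π) c → Pos n c
      Pos-n {c} (1≤c , c≤) = 1≤c , subst (c ≤_) (Member.len mem) c≤

      Pos-σ⁺ : ∀ {j} → Pos k j → j ∈ range 1 (length σ)
      Pos-σ⁺ {j} (1≤j , j≤k) = ∈-range1⁺ _ (1≤j , subst (j ≤_) (sym (length-compress π)) j≤k)

      Pos-σ⁻ : ∀ {j} → j ∈ range 1 (length σ) → Pos k j
      Pos-σ⁻ {j} j∈ = let (1≤j , j≤) = ∈-range1⁻ _ j∈ in 1≤j , subst (j ≤_) (length-compress π) j≤

    board-compress⁺ : ∀ {x y} → Pos k x → Pos k y → D (at cols x) (at π (at cols y)) → T (inBoard lam x (at σ y))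
    board-compress⁺ x∈ y∈ d = let (σy∈ , rows[σy]≡) = compress-row mem y∈ in
      board⁺ σy∈ x∈ (subst (D _) (sym rows[σy]≡) d)

    board-compress⁻ : ∀ {x y} → Pos k y → T (inBoard lam x (at σ y)) → D (at cols x) (at π (at cols y))
    board-compress⁻ y∈ t = let (_ , _ , d) = board⁻ t in subst (D _) (proj₂ (compress-row mem y∈)) d

    compress-<⁺ : ∀ {i j} → Pos k i → Pos k j → at π (at cols j) < at π (at cols i) → at σ j < at σ i
    compress-<⁺ i∈ j∈ lt = let (σi∈ , ei) = compress-row mem i∈ ; (σj∈ , ej) = compress-row mem j∈ in
      at-cancel-< rows rows-sorted (Pos-rows σj∈) (Pos-rows σi∈) (subst₂ _<_ (sym ej) (sym ei) lt)

    compress-<⁻ : ∀ {i j} → Pos k i → Pos k j → at σ j < at σ i → at π (at cols j) < at π (at cols i)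
    compress-<⁻ i∈ j∈ lt = let (σi∈ , ei) = compress-row mem i∈ ; (σj∈ , ej) = compress-row mem j∈ in
      subst₂ _<_ ej ei (at-mono rows rows-sorted (proj₁ σj∈) lt (proj₂ (Pos-rows σi∈)))

    D-column-free : ∀ {c} → Pos n c → D c (at π c) → c ∈ cols
    D-column-free c∈n d = free-column mem c∈n (λ Q-c → Q-nondominant mem Q-c (D⇒dominant mem d))

    pmMatch-P₁⇒free : ∀ {ℓ} → T (pmMatch (P₁ p) 2 π ℓ) → ℓ ∈ cols
    pmMatch-P₁⇒free {ℓ} t = let (_ , _ , ℓ∈ , _ , _ , dom) = P₁-match⁻ π ℓ t in
      D-column-free (Pos-n ℓ∈) (dominant⇒D mem (dominant⁺ π ℓ (at π ℓ) dom))

    pmMatch-P₂⇒free : ∀ {ℓ} → T (pmMatch (P₂ p) 1 π ℓ) → ℓ ∈ cols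
    pmMatch-P₂⇒free {ℓ} t = let (c , _ , ℓ∈ , ℓ<c , _ , dom) = P₂-match⁻ π ℓ t in
      D-column-free (Pos-n ℓ∈) (D-mono (<⇒≤ ℓ<c) ≤-refl (dominant⇒D mem (dominant⁺ π c (at π ℓ) dom)))

    private
      Pos-π-col : ∀ {i} → Pos k i → Pos (length π) (at cols i)
      Pos-π-col i∈ = pos-π mem (proj₁ (∈-cols⁻ (at-cols-∈ i∈)))

      free-position : ∀ {c} → Pos (length π) c → D c (at π c) → ∃ λ j → Pos k j × at cols j ≡ c
      free-position c∈ d = let (j∈ , e) = position-cols (D-column-free (Pos-n c∈) d) in _ , j∈ , e

    P₁-match≡match12 : ∀ {i} → Pos k i → pmMatch (P₁ p) 2 π (at cols i) ≡ match12 lam σ i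
    P₁-match≡match12 {i} i∈ = T-injective (to ∘ P₁-match⁻ π ℓ) from
      where
      ℓ = at cols i
      from-columns : ∀ {j c} → Pos k j → at cols j ≡ c → c < ℓ → at π c < at π ℓ → D ℓ (at π ℓ) → T (match12 lam σ i)
      from-columns j∈ refl c<ℓ πc<πℓ dℓ =
        match12⁺ lam σ (Pos-σ⁺ j∈) (at-cancel-< cols cols-sorted j∈ i∈ c<ℓ) (compress-<⁺ i∈ j∈ πc<πℓ)
          (board-compress⁺ j∈ j∈ (D-mono (<⇒≤ c<ℓ) (<⇒≤ πc<πℓ) dℓ))
          (board-compress⁺ j∈ i∈ (D-mono (<⇒≤ c<ℓ) ≤-refl dℓ))
          (board-compress⁺ i∈ j∈ (D-mono ≤-refl (<⇒≤ πc<πℓ) dℓ))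
          (board-compress⁺ i∈ i∈ dℓ)
      to : P₁Match π ℓ → T (match12 lam σ i)
      to (c , c∈ , _ , c<ℓ , πc<πℓ , dom) =
        let dℓ = dominant⇒D mem (dominant⁺ π ℓ (at π ℓ) dom)
            (_ , j∈ , cols[j]≡c) = free-position c∈ (D-mono (<⇒≤ c<ℓ) (<⇒≤ πc<πℓ) dℓ)
        in from-columns j∈ cols[j]≡c c<ℓ πc<πℓ dℓ
      from : T (match12 lam σ i) → T (pmMatch (P₁ p) 2 π ℓ)
      from t = let (j , j∈σ , j<i , σj<σi , corner) = match12⁻ lam σ t ; j∈ = Pos-σ⁻ j∈σ in
        P₁-match⁺ π ℓ (at cols j , Pos-π-col j∈ , Pos-π-col i∈ , at-mono cols cols-sorted (proj₁ j∈) j<i (proj₂ i∈)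
                      , compress-<⁻ i∈ j∈ σj<σi , dominant⁻ π ℓ (at π ℓ) (D⇒dominant mem (board-compress⁻ i∈ corner)))

    P₂-match≡match21 : ∀ {i} → Pos k i → pmMatch (P₂ p) 1 π (at cols i) ≡ match21 lam σ i
    P₂-match≡match21 {i} i∈ = T-injective (to ∘ P₂-match⁻ π ℓ) from
      where
      ℓ = at cols i
      from-columns : ∀ {j c} → Pos k j → at cols j ≡ c → ℓ < c → at π c < at π ℓ → D c (at π ℓ) → T (match21 lam σ i)
      from-columns j∈ refl ℓ<c πc<πℓ dcℓ =
        match21⁺ lam σ (Pos-σ⁺ j∈) (at-cancel-< cols cols-sorted i∈ j∈ ℓ<c) (compress-<⁺ i∈ j∈ πc<πℓ)
          (board-compress⁺ i∈ j∈ (D-mono (<⇒≤ ℓ<c) (<⇒≤ πc<πℓ) dcℓ))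
          (board-compress⁺ i∈ i∈ (D-mono (<⇒≤ ℓ<c) ≤-refl dcℓ))
          (board-compress⁺ j∈ j∈ (D-mono ≤-refl (<⇒≤ πc<πℓ) dcℓ))
          (board-compress⁺ j∈ i∈ dcℓ)
      to : P₂Match π ℓ → T (match21 lam σ i)
      to (c , c∈ , _ , ℓ<c , πc<πℓ , dom) =
        let dcℓ = dominant⇒D mem (dominant⁺ π c (at π ℓ) dom)
            (_ , j∈ , cols[j]≡c) = free-position c∈ (D-mono ≤-refl (<⇒≤ πc<πℓ) dcℓ)
        in from-columns j∈ cols[j]≡c ℓ<c πc<πℓ dcℓ
      from : T (match21 lam σ i) → T (pmMatch (P₂ p) 1 π ℓ)
      from t = let (j , j∈σ , i<j , σj<σi , corner) = match21⁻ lam σ t ; j∈ = Pos-σ⁻ j∈σ in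
        P₂-match⁺ π ℓ (at cols j , Pos-π-col j∈ , Pos-π-col i∈ , at-mono cols cols-sorted (proj₁ i∈) i<j (proj₂ j∈)
                      , compress-<⁻ i∈ j∈ σj<σi , dominant⁻ π (at cols j) (at π ℓ) (D⇒dominant mem (board-compress⁻ i∈ corner)))

    pmp12-compress : pmp12 lam σ ≡ pmp (P₁ p) 2 π
    pmp12-compress = trans (cong (λ l → countᵇ (match12 lam σ) (range 1 l)) (length-compress π))
      (trans (count-on-free-columns _ _ pmMatch-P₁⇒free P₁-match≡match12)
             (cong (λ l → countᵇ (pmMatch (P₁ p) 2 π) (range 1 l)) (sym (Member.len mem))))

    pmp21-compress : pmp21 lam σ ≡ pmp (P₂ p) 1 π
    pmp21-compress = trans (cong (λ l → countᵇ (match21 lam σ) (range 1 l)) (length-compress π))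
      (trans (count-on-free-columns _ _ pmMatch-P₂⇒free P₂-match≡match21)
             (cong (λ l → countᵇ (pmMatch (P₂ p) 1 π) (range 1 l)) (sym (Member.len mem))))

lemma12 : (m : ℕ) → 4 ≤ m → (p : List ℕ) → p ↭ range 3 (m ∸ 2)
          → (n : ℕ) → 1 ≤ n → (Q : Cells) → Q ⊆grid n
          → (π₀ : List ℕ) → T (inSnQ (red p) Q n π₀)
          → ((k : ℕ) → genPoly (SnQ (red p) Q n) (pmp (P₁ p) 2) k
                       ≡ genPoly (fillings (lambdaQ (red p) Q n π₀)) (pmp12 (lambdaQ (red p) Q n π₀)) k)
            × ((k : ℕ) → genPoly (SnQ (red p) Q n) (pmp (P₂ p) 1) k
                       ≡ genPoly (fillings (lambdaQ (red p) Q n π₀)) (pmp21 (lambdaQ (red p) Q n π₀)) k)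
lemma12 m 4≤m p p↭ n _ Q Q⊆grid π₀ π₀∈ =
  genPoly-compress (pmp (P₁ p) 2) (pmp12 lam) pmp12-compress ,
  genPoly-compress (pmp (P₂ p) 1) (pmp21 lam) pmp21-compress
  where
  open Board (red p) Q n Q⊆grid
  open Compression π₀ π₀∈
  open Statistics m 4≤m p p↭ Q n Q⊆grid π₀ π₀∈
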